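{- Let $\lambda$ be a partition with $s(\lambda)=0$ and let $\mu$ be its staircase, of width $w$. Then $b(\lambda/\mu)\le 2w+1$, where $b(\lambda/\mu)$ denotes the number of boxes of the skew shape $\lambda/\mu$ that lie outside the first column.
   Context: Partitions are identified with Young diagrams. A skew shape $\gamma$ can be peeled from $\lambda$ if there is a partition $\lambda'\subseteq\lambda$ such that $\lambda/\lambda'$ equals $\gamma$ after deleting empty rows and columns. A domino is a $1\times2$ or $2\times1$ block. The domino number $d(\lambda)$ is the maximum number of dominos that can be peeled successively from $\lambda$; the result of peeling $d(\lambda)$ dominos is always the same staircase $\mu=(w,w-1,\dots,1)$, the staircase of $\lambda$, and $w$ is its width. The non-vanishing tetrominos are the following nine 4-box skew shapes (coordinates (row, column), up to deleting empty rows/columns): a row of 4 boxes; the $2\times2$ square; $\{(1,2),(2,1),(2,2),(3,1)\}$; $\{(1,1),(1,2),(1,3),(2,1)\}$; $\{(1,3),(2,1),(2,2),(2,3)\}$; and the four shapes consisting of two dominos in disjoint rows and disjoint columns, one strictly north-east of the other, in each of the four combinations of orientations. $s(\lambda)$ is the maximum number of non-vanishing tetrominos that can be peeled successively from $\lambda$. -}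

module Defs where

open import Data.Nat using (ℕ; zero; suc; _+_; _*_; _∸_; _≤_; _<_; _≥_; _≤?_; _<?_; _≟_)
open import Data.Nat.Properties using ()
open import Data.Product using (_×_; _,_; proj₁; proj₂; Σ; ∃)
open import Data.List using (List; []; _∷_; length; map; filter; upTo; concatMap)
open import Data.List.Relation.Unary.All using (All)
open import Data.List.Relation.Unary.Any using (any?)
open import Data.List.Relation.Unary.Linked using (Linked)
open import Data.List.Membership.Propositional using (_∈_)
open import Relation.Binary.PropositionalEquality using (_≡_)
open import Function.Bundles using (_⇔_)

IsPartition : List ℕ → Set
IsPartition p = Linked _≥_ p × All (λ x → 0 < x) p

-- i-th part (0-indexed), 0 beyond the length.
part : List ℕ → ℕ → ℕ
part []       _       = 0
part (x ∷ _)  zero    = x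
part (_ ∷ xs) (suc i) = part xs i

_⊆ᵖ_ : List ℕ → List ℕ → Set
p ⊆ᵖ q = ∀ i → part p i ≤ part q i

-- A cell is (row, column), 0-indexed, English convention (rows go down).
Cell : Set
Cell = ℕ × ℕ

range : ℕ → ℕ → List ℕ
range a b = map (a +_) (upTo (b ∸ a))

skewCells : List ℕ → List ℕ → List Cell
skewCells la mu = concatMap (λ i → map (λ j → (i , j)) (range (part mu i) (part la i))) (upTo (length la))

-- deleting empty rows and columns: renumber each row (column) by the
-- number of occupied rows (columns) strictly before it
rowRank : List Cell → ℕ → ℕ
rowRank S i = length (filter (λ r → any? (λ c → proj₁ c ≟ r) S) (upTo i))

colRank : List Cell → ℕ → ℕ
colRank S j = length (filter (λ k → any? (λ c → proj₂ c ≟ k) S) (upTo j))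

compress : List Cell → List Cell
compress S = map (λ c → (rowRank S (proj₁ c) , colRank S (proj₂ c))) S

SameCells : List Cell → List Cell → Set
SameCells A B = ∀ c → (c ∈ A) ⇔ (c ∈ B)

-- the shape γ (given by its cells, with no empty rows/columns) can be
-- peeled from la, leaving la'
Peel : List Cell → List ℕ → List ℕ → Set
Peel γ la la' = IsPartition la' × la' ⊆ᵖ la × SameCells (compress (skewCells la la')) γ

data PeelSeq (F : List (List Cell)) : List ℕ → ℕ → List ℕ → Set where
  done : ∀ {la} → PeelSeq F la 0 la
  step : ∀ {la la' n mu} (γ : List Cell) → γ ∈ F → Peel γ la la' →
         PeelSeq F la' n mu → PeelSeq F la (suc n) mu

MaxPeel : List (List Cell) → List ℕ → ℕ → Set
MaxPeel F la n = (∃ λ mu → PeelSeq F la n mu) × (∀ m mu → PeelSeq F la m mu → m ≤ n)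

dominos : List (List Cell)
dominos = ((0 , 0) ∷ (0 , 1) ∷ []) ∷ ((0 , 0) ∷ (1 , 0) ∷ []) ∷ []

-- the nine non-vanishing tetrominos (0-indexed coordinates)
tetrominos : List (List Cell)
tetrominos =
    ((0 , 0) ∷ (0 , 1) ∷ (0 , 2) ∷ (0 , 3) ∷ [])
  ∷ ((0 , 0) ∷ (0 , 1) ∷ (1 , 0) ∷ (1 , 1) ∷ [])
  ∷ ((0 , 1) ∷ (1 , 0) ∷ (1 , 1) ∷ (2 , 0) ∷ [])
  ∷ ((0 , 0) ∷ (0 , 1) ∷ (0 , 2) ∷ (1 , 0) ∷ [])
  ∷ ((0 , 2) ∷ (1 , 0) ∷ (1 , 1) ∷ (1 , 2) ∷ [])
  -- two dominos, one strictly north-east of the other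
  ∷ ((0 , 2) ∷ (0 , 3) ∷ (1 , 0) ∷ (1 , 1) ∷ [])
  ∷ ((0 , 1) ∷ (1 , 1) ∷ (2 , 0) ∷ (3 , 0) ∷ [])
  ∷ ((0 , 1) ∷ (0 , 2) ∷ (1 , 0) ∷ (2 , 0) ∷ [])
  ∷ ((0 , 2) ∷ (1 , 2) ∷ (2 , 0) ∷ (2 , 1) ∷ [])
  ∷ []

TetNumber : List ℕ → ℕ → Set
TetNumber la k = MaxPeel tetrominos la k

StaircaseOf : List ℕ → List ℕ → Set
StaircaseOf la mu = Σ ℕ λ d → MaxPeel dominos la d × PeelSeq dominos la d mu

-- width of a staircase (w, w-1, ..., 1): its first part
width : List ℕ → ℕ
width mu = part mu 0

b : List ℕ → List ℕ → ℕ
b la mu = length (filter (λ c → 1 ≤? proj₂ c) (skewCells la mu))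

-- Peeling a domino preserves the alternating sum Σᵢ (−1)ⁱ (λᵢ mod 2): a horizontal domino
-- keeps every parity, a vertical one flips the parities of two equal consecutive rows.  This
-- sum separates staircases, so the staircase of λ is the one with the same alternating sum.
-- If no tetromino can be peeled, adding the rows of λ from the bottom up shows that λ is a
-- staircase followed by a column of 1s, a staircase (p + 1, …, 1) raised by q + 2 on top of
-- (q, …, 1), or (m + 2, m + 1, …, 2): any other new top row makes one of the nine tetrominos
-- peelable.  In each case the staircase is read off the invariant and the boxes of λ/μ
-- outside the first column are counted directly.

module Submission where

open import Data.Empty
open import Data.Integer using (ℤ; -_) renaming (+_ to pos; _+_ to _+ℤ_; _-_ to _-ℤ_)
import Data.Integer.Properties as ℤ
open import Data.Integer.Tactic.RingSolver using (solve-∀)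
open import Data.List using (List; []; _∷_; length; map; filter; upTo; concatMap; _++_; applyUpTo; replicate; [_])
open import Data.List.Properties using (length-++; filter-++; filter-accept; filter-reject; filter-all; length-map; upTo-∷ʳ; length-upTo; length-applyUpTo)
open import Data.List.Membership.Propositional using (_∈_; find; lose)
open import Data.List.Membership.Propositional.Properties using (∈-map⁺; ∈-map⁻; ∈-concatMap⁺; ∈-concatMap⁻; ∈-upTo⁺; ∈-upTo⁻)
open import Data.List.Relation.Unary.All using (All; []; _∷_)
import Data.List.Relation.Unary.All as All
open import Data.List.Relation.Unary.All.Properties using (map⁺; applyUpTo⁺₂)
open import Data.List.Relation.Unary.Any using (Any; here; there; any?)
open import Data.List.Relation.Unary.Linked using ([]; [-]; _∷_)
open import Data.Nat using (ℕ; zero; suc; _+_; _*_; _∸_; _≤_; _<_; _≤?_; _<?_; _≟_; z≤n; s≤s; _⊔_)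
open import Data.Nat.Properties
open import Data.Product using (_×_; _,_; proj₁; proj₂; ∃)
open import Data.Sum using (_⊎_; inj₁; inj₂)
open import Data.Unit using (tt)
open import Function.Base using (_∘_)
open import Function.Bundles using (mk⇔; Equivalence)
open import Relation.Binary.Definitions using (tri<; tri≈; tri>)
open import Relation.Binary.PropositionalEquality hiding ([_])
open import Relation.Nullary
open import Relation.Nullary.Decidable using (_×-dec_; toWitness)

open import Defs

-- Counting below a bound

count : {P : ℕ → Set} → (∀ n → Dec (P n)) → ℕ → ℕ
count P? n = length (filter P? (upTo n))

module _ {P : ℕ → Set} (P? : ∀ n → Dec (P n)) where

  count-suc : ∀ n → count P? (suc n) ≡ count P? n + length (filter P? [ n ])
  count-suc n = begin
      length (filter P? (upTo (suc n)))              ≡⟨ cong (λ l → length (filter P? l)) (upTo-∷ʳ n) ⟨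
      length (filter P? (upTo n ++ [ n ]))           ≡⟨ cong length (filter-++ P? (upTo n) [ n ]) ⟩
      length (filter P? (upTo n) ++ filter P? [ n ]) ≡⟨ length-++ (filter P? (upTo n)) ⟩
      count P? n + length (filter P? [ n ])          ∎
    where open ≡-Reasoning

  count-suc-yes : ∀ n → P n → count P? (suc n) ≡ suc (count P? n)
  count-suc-yes n p = trans (count-suc n) (trans (cong (λ l → count P? n + length l) (filter-accept P? p)) (+-comm _ 1))

  count-suc-no : ∀ n → ¬ P n → count P? (suc n) ≡ count P? n
  count-suc-no n ¬p = trans (count-suc n) (trans (cong (λ l → count P? n + length l) (filter-reject P? ¬p)) (+-identityʳ _))

  count-monotone : ∀ {m n} → m ≤ n → count P? m ≤ count P? n
  count-monotone {n = zero} z≤n = ≤-refl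
  count-monotone {m} {suc n} m≤1+n with m≤n⇒m<n∨m≡n m≤1+n
  ... | inj₂ refl = ≤-refl
  ... | inj₁ (s≤s m≤n) = ≤-trans (count-monotone m≤n) (≤-trans (m≤m+n _ _) (≤-reflexive (sym (count-suc n))))

  count-strict : ∀ {m n} → P m → m < n → count P? m < count P? n
  count-strict {m} p m<n = ≤-trans (≤-reflexive (sym (count-suc-yes m p))) (count-monotone m<n)

  count-skip : ∀ m t → (∀ k → m ≤ k → k < m + t → ¬ P k) → count P? (m + t) ≡ count P? m
  count-skip m zero _ = cong (count P?) (+-identityʳ m)
  count-skip m (suc t) ¬P = begin
      count P? (m + suc t)    ≡⟨ cong (count P?) (+-suc m t) ⟩
      count P? (suc (m + t))  ≡⟨ count-suc-no (m + t) (¬P (m + t) (m≤m+n m t) (+-monoʳ-< m ≤-refl)) ⟩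
      count P? (m + t)        ≡⟨ count-skip m t (λ k m≤k k< → ¬P k m≤k (<-≤-trans k< (+-monoʳ-≤ m (n≤1+n t)))) ⟩
      count P? m              ∎
    where open ≡-Reasoning

  count-run : ∀ m t → (∀ k → m ≤ k → k < m + t → P k) → count P? (m + t) ≡ count P? m + t
  count-run m zero _ = trans (cong (count P?) (+-identityʳ m)) (sym (+-identityʳ _))
  count-run m (suc t) allP = begin
      count P? (m + suc t)     ≡⟨ cong (count P?) (+-suc m t) ⟩
      count P? (suc (m + t))   ≡⟨ count-suc-yes (m + t) (allP (m + t) (m≤m+n m t) (+-monoʳ-< m ≤-refl)) ⟩
      suc (count P? (m + t))   ≡⟨ cong suc (count-run m t (λ k m≤k k< → allP k m≤k (<-≤-trans k< (+-monoʳ-≤ m (n≤1+n t))))) ⟩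
      suc (count P? m + t)     ≡⟨ +-suc _ t ⟨
      count P? m + suc t       ∎
    where open ≡-Reasoning

  count-none : ∀ m → (∀ k → k < m → ¬ P k) → count P? m ≡ 0
  count-none m ¬P = count-skip 0 m (λ k _ → ¬P k)

count-cong : {P Q : ℕ → Set} (P? : ∀ n → Dec (P n)) (Q? : ∀ n → Dec (Q n)) → ∀ n →
  (∀ k → k < n → P k → Q k) → (∀ k → k < n → Q k → P k) → count P? n ≡ count Q? n
count-cong P? Q? zero _ _ = refl
count-cong P? Q? (suc n) P⇒Q Q⇒P with P? n
... | yes p = trans (count-suc-yes P? n p) (trans (cong suc ih) (sym (count-suc-yes Q? n (P⇒Q n ≤-refl p))))
  where ih = count-cong P? Q? n (λ k k< → P⇒Q k (m<n⇒m<1+n k<)) (λ k k< → Q⇒P k (m<n⇒m<1+n k<))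
... | no ¬p = trans (count-suc-no P? n ¬p) (trans ih (sym (count-suc-no Q? n (λ q → ¬p (Q⇒P n ≤-refl q)))))
  where ih = count-cong P? Q? n (λ k k< → P⇒Q k (m<n⇒m<1+n k<)) (λ k k< → Q⇒P k (m<n⇒m<1+n k<))

count-shift : {P Q : ℕ → Set} (P? : ∀ n → Dec (P n)) (Q? : ∀ n → Dec (Q n)) →
  ¬ P 0 → (∀ k → P (suc k) → Q k) → (∀ k → Q k → P (suc k)) → ∀ n → count P? (suc n) ≡ count Q? n
count-shift P? Q? ¬P0 P⇒Q Q⇒P zero = count-suc-no P? 0 ¬P0
count-shift P? Q? ¬P0 P⇒Q Q⇒P (suc n) with Q? n
... | yes q = trans (count-suc-yes P? (suc n) (Q⇒P n q)) (trans (cong suc ih) (sym (count-suc-yes Q? n q)))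
  where ih = count-shift P? Q? ¬P0 P⇒Q Q⇒P n
... | no ¬q = trans (count-suc-no P? (suc n) (λ p → ¬q (P⇒Q n p))) (trans ih (sym (count-suc-no Q? n ¬q)))
  where ih = count-shift P? Q? ¬P0 P⇒Q Q⇒P n

module _ {P : ℕ → Set} (P? : ∀ n → Dec (P n)) (R : ℕ → ℕ) (h : ℕ)
  (R-step : ∀ a → suc a < h → R a < R (suc a))
  (P⇒image : ∀ k → P k → ∃ λ a → a < h × R a ≡ k) (image⇒P : ∀ a → a < h → P (R a)) where

  R-strict : ∀ {a b} → a < b → b < h → R a < R b
  R-strict {a} {suc b} (s≤s a≤b) b<h with m≤n⇒m<n∨m≡n a≤b
  ... | inj₂ refl = R-step a b<h
  ... | inj₁ a<b = <-trans (R-strict a<b (<-trans (n<1+n b) b<h)) (R-step b b<h)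

  R-monotone : ∀ {a b} → a ≤ b → b < h → R a ≤ R b
  R-monotone a≤b b<h with m≤n⇒m<n∨m≡n a≤b
  ... | inj₁ a<b = <⇒≤ (R-strict a<b b<h)
  ... | inj₂ refl = ≤-refl

  private
    no-image-between : ∀ a a' k → suc a < h → a' < h → R a' ≡ k → R a < k → k < R (suc a) → ⊥
    no-image-between a a' k sa<h a'<h refl R<k k<R with <-cmp a' a
    ... | tri< a'<a _ _ = <-irrefl refl (≤-trans R<k (R-monotone (<⇒≤ a'<a) (<-trans (n<1+n a) sa<h)))
    ... | tri≈ _ refl _ = <-irrefl refl R<k
    ... | tri> _ _ a<a' = <-irrefl refl (≤-trans k<R (R-monotone a<a' a'<h))

  count-image : ∀ a → a < h → count P? (R a) ≡ a
  count-image zero 0<h = count-none P? (R 0) λ k k<R0 pk →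
    let (a' , a'<h , eq) = P⇒image k pk in
    <-irrefl refl (≤-trans (subst (λ x → suc x ≤ R 0) (sym eq) k<R0) (R-monotone z≤n a'<h))
  count-image (suc a) sa<h = begin
      count P? (R (suc a))                         ≡⟨ cong (count P?) (m+[n∸m]≡n Ra<) ⟨
      count P? (suc (R a) + (R (suc a) ∸ suc (R a))) ≡⟨ count-skip P? (suc (R a)) _ gap ⟩
      count P? (suc (R a))                         ≡⟨ count-suc-yes P? (R a) (image⇒P a (<-trans (n<1+n a) sa<h)) ⟩
      suc (count P? (R a))                         ≡⟨ cong suc (count-image a (<-trans (n<1+n a) sa<h)) ⟩
      suc a                                        ∎
    where
    open ≡-Reasoning
    Ra< = R-step a sa<h
    gap : ∀ k → suc (R a) ≤ k → k < suc (R a) + (R (suc a) ∸ suc (R a)) → ¬ P k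
    gap k R<k k< pk = let (a' , a'<h , e) = P⇒image k pk in
      no-image-between a a' k sa<h a'<h e R<k (subst (k <_) (m+[n∸m]≡n Ra<) k<)

part-suc≤part : ∀ {l} → IsPartition l → ∀ i → part l (suc i) ≤ part l i
part-suc≤part {[]}         _               _       = z≤n
part-suc≤part {x ∷ []}     _               _       = z≤n
part-suc≤part {x ∷ y ∷ l}  (y≤x ∷ _ , _)     zero    = y≤x
part-suc≤part {x ∷ y ∷ l}  (_ ∷ lk , _ ∷ ps) (suc i) = part-suc≤part {y ∷ l} (lk , ps) i

part-antitone : ∀ {l} → IsPartition l → ∀ {i j} → i ≤ j → part l j ≤ part l i
part-antitone pl {j = zero} z≤n = ≤-refl
part-antitone pl {i} {suc j} i≤1+j with m≤n⇒m<n∨m≡n i≤1+j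
... | inj₂ refl = ≤-refl
... | inj₁ (s≤s i≤j) = ≤-trans (part-suc≤part pl j) (part-antitone pl i≤j)

part-beyond : ∀ l i → length l ≤ i → part l i ≡ 0
part-beyond []      i       _         = refl
part-beyond (x ∷ l) (suc i) (s≤s le) = part-beyond l i le

part>0⇒<length : ∀ l i → 0 < part l i → i < length l
part>0⇒<length (x ∷ l) zero    _ = s≤s z≤n
part>0⇒<length (x ∷ l) (suc i) p = s≤s (part>0⇒<length l i p)

IsPartition-tail : ∀ {x l} → IsPartition (x ∷ l) → IsPartition l
IsPartition-tail ([-] , _ ∷ ps)    = [] , ps
IsPartition-tail (_ ∷ lk , _ ∷ ps) = lk , ps

IsPartition-head>0 : ∀ {x l} → IsPartition (x ∷ l) → 0 < x
IsPartition-head>0 (_ , x>0 ∷ _) = x>0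

IsPartition-∷ : ∀ {x l} → 0 < x → part l 0 ≤ x → IsPartition l → IsPartition (x ∷ l)
IsPartition-∷ {l = []}    x>0 _   (lk , ps) = [-] , x>0 ∷ ps
IsPartition-∷ {l = y ∷ l} x>0 y≤x (lk , ps) = y≤x ∷ lk , x>0 ∷ ps

Decreasing : (ℕ → ℕ) → Set
Decreasing g = ∀ i → g (suc i) ≤ g i

-- truncated at the first zero part
fromParts : ℕ → (ℕ → ℕ) → List ℕ
fromParts zero    g = []
fromParts (suc n) g with g 0
... | zero  = []
... | suc x = suc x ∷ fromParts n (λ i → g (suc i))

fromParts-head≤ : ∀ n g → part (fromParts n g) 0 ≤ g 0
fromParts-head≤ zero    g = z≤n
fromParts-head≤ (suc n) g with g 0
... | zero  = z≤n
... | suc x = ≤-refl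

fromParts-isPartition : ∀ n g → Decreasing g → IsPartition (fromParts n g)
fromParts-isPartition zero    g dec = [] , []
fromParts-isPartition (suc n) g dec with g 0 in eq
... | zero  = [] , []
... | suc x = IsPartition-∷ (s≤s z≤n)
      (≤-trans (fromParts-head≤ n (λ i → g (suc i))) (subst (g 1 ≤_) eq (dec 0)))
      (fromParts-isPartition n (λ i → g (suc i)) (λ i → dec (suc i)))

part-fromParts : ∀ n g → Decreasing g → (∀ i → n ≤ i → g i ≡ 0) → ∀ i → part (fromParts n g) i ≡ g i
part-fromParts zero    g dec g0 i = sym (g0 i z≤n)
part-fromParts (suc n) g dec g0 i with g 0 in eq
... | zero = sym (n≤0⇒n≡0 (subst (g i ≤_) eq (g≤g0 i)))
  where g≤g0 : ∀ i → g i ≤ g 0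
        g≤g0 zero    = ≤-refl
        g≤g0 (suc i) = ≤-trans (dec i) (g≤g0 i)
part-fromParts (suc n) g dec g0 zero    | suc x = sym eq
part-fromParts (suc n) g dec g0 (suc i) | suc x =
  part-fromParts n (λ i → g (suc i)) (λ i → dec (suc i)) (λ i le → g0 (suc i) (s≤s le)) i

-- Skew cells and compression

∈-range⁻ : ∀ {a b j} → j ∈ range a b → a ≤ j × j < b
∈-range⁻ {a} {b} j∈ with ∈-map⁻ (a +_) j∈
... | t , t∈ , refl = m≤m+n a t , subst (a + t <_) (m+[n∸m]≡n (<⇒≤ a<b)) (+-monoʳ-< a (∈-upTo⁻ t∈))
  where a<b : a < b
        a<b = m∸n≢0⇒n<m λ b∸a≡0 → n≮0 (subst (t <_) b∸a≡0 (∈-upTo⁻ t∈))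

∈-range⁺ : ∀ {a b j} → a ≤ j → j < b → j ∈ range a b
∈-range⁺ {a} {b} a≤j j<b = subst (_∈ range a b) (m+[n∸m]≡n a≤j) (∈-map⁺ (a +_) (∈-upTo⁺ (∸-monoˡ-< j<b a≤j)))

∈-skewCells⁻ : ∀ {la mu i j} → (i , j) ∈ skewCells la mu → i < length la × part mu i ≤ j × j < part la i
∈-skewCells⁻ {la} {mu} c∈ with find (∈-concatMap⁻ (λ i → map (i ,_) (range (part mu i) (part la i))) {xs = upTo (length la)} c∈)
... | i , i∈ , c∈row with ∈-map⁻ (i ,_) c∈row
... | j , j∈ , refl = ∈-upTo⁻ i∈ , ∈-range⁻ j∈

∈-skewCells⁺ : ∀ {la mu i j} → part mu i ≤ j → j < part la i → (i , j) ∈ skewCells la mu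
∈-skewCells⁺ {la} {mu} {i} mu≤j j<la = ∈-concatMap⁺ (λ i → map (i ,_) (range (part mu i) (part la i))) {xs = upTo (length la)}
  (lose (∈-upTo⁺ (part>0⇒<length la i (≤-<-trans z≤n j<la))) (∈-map⁺ (i ,_) (∈-range⁺ mu≤j j<la)))

-- rowRank S and colRank S are, by definition, count (rowOccupied? S) and count (colOccupied? S).
RowOccupied : List Cell → ℕ → Set
RowOccupied S r = Any (λ c → proj₁ c ≡ r) S

rowOccupied? : (S : List Cell) → ∀ r → Dec (RowOccupied S r)
rowOccupied? S r = any? (λ c → proj₁ c ≟ r) S

ColOccupied : List Cell → ℕ → Set
ColOccupied S k = Any (λ c → proj₂ c ≡ k) S

colOccupied? : (S : List Cell) → ∀ k → Dec (ColOccupied S k)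
colOccupied? S k = any? (λ c → proj₂ c ≟ k) S

relabel : List Cell → Cell → Cell
relabel S c = rowRank S (proj₁ c) , colRank S (proj₂ c)

∈-compress⁻ : ∀ {S c} → c ∈ compress S → ∃ λ s → s ∈ S × c ≡ relabel S s
∈-compress⁻ {S} = ∈-map⁻ (relabel S)

∈-compress⁺ : ∀ {S s} → s ∈ S → relabel S s ∈ compress S
∈-compress⁺ {S} = ∈-map⁺ (relabel S)

Spans : List Cell → ℕ → ℕ → Set
Spans γ h w = All (λ e → proj₁ e < h) γ × All (λ a → RowOccupied γ a) (upTo h)
            × All (λ e → proj₂ e < w) γ × All (λ b → ColOccupied γ b) (upTo w)

spans? : ∀ γ h w → Dec (Spans γ h w)
spans? γ h w = All.all? (λ e → proj₁ e <? h) γ ×-dec All.all? (rowOccupied? γ) (upTo h)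
         ×-dec All.all? (λ e → proj₂ e <? w) γ ×-dec All.all? (colOccupied? γ) (upTo w)

-- If the cells of la / la' are exactly the images of the cells of γ under strictly
-- increasing row and column maps R and C, then la / la' compresses to γ, because
-- R a is the a-th occupied row and C b the b-th occupied column.
module PeelByEmbedding
  (la : List ℕ) (g : ℕ → ℕ) (g-dec : Decreasing g) (g≤la : ∀ i → g i ≤ part la i)
  (γ : List Cell) (h w : ℕ) (γ-spans : Spans γ h w) (R C : ℕ → ℕ)
  (R-step : ∀ a → suc a < h → R a < R (suc a)) (C-step : ∀ b → suc b < w → C b < C (suc b))
  (onto : ∀ i j → g i ≤ j → j < part la i → ∃ λ e → e ∈ γ × i ≡ R (proj₁ e) × j ≡ C (proj₂ e))
  (into : ∀ e → e ∈ γ → g (R (proj₁ e)) ≤ C (proj₂ e) × C (proj₂ e) < part la (R (proj₁ e))) where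

  private
    la' : List ℕ
    la' = fromParts (length la) g

    part-la' : ∀ i → part la' i ≡ g i
    part-la' = part-fromParts (length la) g g-dec
      (λ i le → n≤0⇒n≡0 (≤-trans (g≤la i) (≤-reflexive (part-beyond la i le))))

    S : List Cell
    S = skewCells la la'

    ∈S⁻ : ∀ {i j} → (i , j) ∈ S → g i ≤ j × j < part la i
    ∈S⁻ c∈ with ∈-skewCells⁻ {la} {la'} c∈
    ... | _ , la'≤j , j<la = subst (_≤ _) (part-la' _) la'≤j , j<la

    image∈S : ∀ e → e ∈ γ → (R (proj₁ e) , C (proj₂ e)) ∈ S
    image∈S e e∈ = let (g≤ , <la) = into e e∈ in ∈-skewCells⁺ {la} {la'} (subst (_≤ _) (sym (part-la' _)) g≤) <la

    γ-row< : ∀ e → e ∈ γ → proj₁ e < h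
    γ-row< e = All.lookup (proj₁ γ-spans)

    γ-col< : ∀ e → e ∈ γ → proj₂ e < w
    γ-col< e = All.lookup (proj₁ (proj₂ (proj₂ γ-spans)))

    rank-R : ∀ a → a < h → rowRank S (R a) ≡ a
    rank-R = count-image (rowOccupied? S) R h R-step preimage occupied
      where
      preimage : ∀ k → RowOccupied S k → ∃ λ a → a < h × R a ≡ k
      preimage k occ with find occ
      ... | (i , j) , c∈ , refl with ∈S⁻ c∈
      ... | g≤j , j<la with onto i j g≤j j<la
      ... | e , e∈ , refl , _ = proj₁ e , γ-row< e e∈ , refl
      occupied : ∀ a → a < h → RowOccupied S (R a)
      occupied a a<h with find (All.lookup (proj₁ (proj₂ γ-spans)) (∈-upTo⁺ a<h))
      ... | e , e∈ , refl = lose (image∈S e e∈) refl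

    rank-C : ∀ b → b < w → colRank S (C b) ≡ b
    rank-C = count-image (colOccupied? S) C w C-step preimage occupied
      where
      preimage : ∀ k → ColOccupied S k → ∃ λ b → b < w × C b ≡ k
      preimage k occ with find occ
      ... | (i , j) , c∈ , refl with ∈S⁻ c∈
      ... | g≤j , j<la with onto i j g≤j j<la
      ... | e , e∈ , _ , refl = proj₂ e , γ-col< e e∈ , refl
      occupied : ∀ b → b < w → ColOccupied S (C b)
      occupied b b<w with find (All.lookup (proj₂ (proj₂ (proj₂ γ-spans))) (∈-upTo⁺ b<w))
      ... | e , e∈ , refl = lose (image∈S e e∈) refl

    relabel-image : ∀ e → e ∈ γ → relabel S (R (proj₁ e) , C (proj₂ e)) ≡ e
    relabel-image e e∈ = cong₂ _,_ (rank-R (proj₁ e) (γ-row< e e∈)) (rank-C (proj₂ e) (γ-col< e e∈))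

    compress≈γ : SameCells (compress S) γ
    compress≈γ c = mk⇔ to from
      where
      to : c ∈ compress S → c ∈ γ
      to c∈ with ∈-compress⁻ {S} c∈
      ... | (i , j) , s∈ , refl with ∈S⁻ s∈
      ... | g≤j , j<la with onto i j g≤j j<la
      ... | e , e∈ , refl , refl = subst (_∈ γ) (sym (relabel-image e e∈)) e∈
      from : c ∈ γ → c ∈ compress S
      from c∈ = subst (_∈ compress S) (relabel-image c c∈) (∈-compress⁺ {S} (image∈S c c∈))

  peel : ∃ λ la' → Peel γ la la'
  peel = la' , fromParts-isPartition (length la) g g-dec
             , (λ i → subst (_≤ part la i) (sym (part-la' i)) (g≤la i)) , compress≈γ

module _ (a : ℕ) (l l' : List ℕ) where
  private
    S S⁺ : List Cell
    S  = skewCells l l'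
    S⁺ = skewCells (a ∷ l) (a ∷ l')

    ∈S⁺⁻ : ∀ {i j} → (i , j) ∈ S⁺ → ∃ λ i' → i ≡ suc i' × (i' , j) ∈ S
    ∈S⁺⁻ {zero}  c∈ with ∈-skewCells⁻ {a ∷ l} {a ∷ l'} c∈
    ... | _ , a≤j , j<a = ⊥-elim (<-irrefl refl (≤-trans j<a a≤j))
    ∈S⁺⁻ {suc i} c∈ with ∈-skewCells⁻ {a ∷ l} {a ∷ l'} c∈
    ... | _ , l'≤j , j<l = i , refl , ∈-skewCells⁺ {l} {l'} l'≤j j<l

    ∈S⁺⁺ : ∀ {i j} → (i , j) ∈ S → (suc i , j) ∈ S⁺
    ∈S⁺⁺ c∈ with ∈-skewCells⁻ {l} {l'} c∈
    ... | _ , l'≤j , j<l = ∈-skewCells⁺ {a ∷ l} {a ∷ l'} l'≤j j<l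

    rowRank-suc : ∀ i → rowRank S⁺ (suc i) ≡ rowRank S i
    rowRank-suc = count-shift (rowOccupied? S⁺) (rowOccupied? S) ¬row0 down up
      where
      ¬row0 : ¬ RowOccupied S⁺ 0
      ¬row0 occ with find occ
      ... | _ , c∈ , refl with ∈S⁺⁻ c∈
      ... | _ , () , _
      down : ∀ k → RowOccupied S⁺ (suc k) → RowOccupied S k
      down k occ with find occ
      ... | _ , c∈ , refl with ∈S⁺⁻ c∈
      ... | _ , refl , c∈S = lose c∈S refl
      up : ∀ k → RowOccupied S k → RowOccupied S⁺ (suc k)
      up k occ with find occ
      ... | _ , c∈ , refl = lose (∈S⁺⁺ c∈) refl

    colRank-same : ∀ j → colRank S⁺ j ≡ colRank S j
    colRank-same j = count-cong (colOccupied? S⁺) (colOccupied? S) j down up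
      where
      down : ∀ k → k < j → ColOccupied S⁺ k → ColOccupied S k
      down k _ occ with find occ
      ... | _ , c∈ , refl with ∈S⁺⁻ c∈
      ... | _ , refl , c∈S = lose c∈S refl
      up : ∀ k → k < j → ColOccupied S k → ColOccupied S⁺ k
      up k _ occ with find occ
      ... | _ , c∈ , refl = lose (∈S⁺⁺ c∈) refl

    relabel-suc : ∀ i j → relabel S⁺ (suc i , j) ≡ relabel S (i , j)
    relabel-suc i j = cong₂ _,_ (rowRank-suc i) (colRank-same j)

  compress-∷ : ∀ γ → SameCells (compress S) γ → SameCells (compress S⁺) γ
  compress-∷ γ S≈γ c = mk⇔ to from
    where
    to : c ∈ compress S⁺ → c ∈ γ
    to c∈ with ∈-compress⁻ {S⁺} c∈
    ... | (_ , j) , s∈ , refl with ∈S⁺⁻ s∈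
    ... | i , refl , s∈S = Equivalence.to (S≈γ _) (subst (_∈ compress S) (sym (relabel-suc i j)) (∈-compress⁺ {S} s∈S))
    from : c ∈ γ → c ∈ compress S⁺
    from c∈ with ∈-compress⁻ {S} (Equivalence.from (S≈γ c) c∈)
    ... | (i , j) , s∈ , refl = subst (_∈ compress S⁺) (relabel-suc i j) (∈-compress⁺ {S⁺} (∈S⁺⁺ s∈))

Peel-∷ : ∀ {γ l l'} a → 0 < a → part l 0 ≤ a → Peel γ l l' → Peel γ (a ∷ l) (a ∷ l')
Peel-∷ {γ} {l} {l'} a a>0 l≤a (pl' , l'⊆l , S≈γ) =
  IsPartition-∷ a>0 (≤-trans (l'⊆l 0) l≤a) pl' , ⊆-∷ , compress-∷ a l l' γ S≈γ
  where
  ⊆-∷ : (a ∷ l') ⊆ᵖ (a ∷ l)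
  ⊆-∷ zero    = ≤-refl
  ⊆-∷ (suc i) = l'⊆l i

noPeel : ∀ {la γ la'} → TetNumber la 0 → γ ∈ tetrominos → Peel γ la la' → ⊥
noPeel (_ , maximal) γ∈ p = 1+n≰n (maximal 1 _ (step _ γ∈ p done))

TetNumber0-tail : ∀ {a l} → IsPartition (a ∷ l) → TetNumber (a ∷ l) 0 → TetNumber l 0
TetNumber0-tail {a} {l} pal s0 = (l , done) , maximal
  where
  maximal : ∀ m mu → PeelSeq tetrominos l m mu → m ≤ 0
  maximal zero    _ _                = z≤n
  maximal (suc m) _ (step γ γ∈ p _) =
    ⊥-elim (noPeel s0 γ∈ (Peel-∷ a (IsPartition-head>0 pal) (part-suc≤part pal 0) p))

-- Domino removals and the parity invariant

horizontal vertical : List Cell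
horizontal = (0 , 0) ∷ (0 , 1) ∷ []
vertical   = (0 , 0) ∷ (1 , 0) ∷ []

HorizontalRemoval : List ℕ → List ℕ → Set
HorizontalRemoval la la' = ∃ λ r → part la' r + 2 ≡ part la r × (∀ i → i ≢ r → part la' i ≡ part la i)

VerticalRemoval : List ℕ → List ℕ → Set
VerticalRemoval la la' = ∃ λ r → part la' r + 1 ≡ part la r × part la' (suc r) + 1 ≡ part la (suc r)
  × part la r ≡ part la (suc r) × (∀ i → i ≢ r → i ≢ suc r → part la' i ≡ part la i)

module DominoRemoval (la la' : List ℕ) (pla : IsPartition la) (pla' : IsPartition la') (la'⊆la : la' ⊆ᵖ la) where
  private
    S : List Cell
    S = skewCells la la'

    ∈S⁻ : ∀ {i j} → (i , j) ∈ S → part la' i ≤ j × j < part la i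
    ∈S⁻ c∈ = proj₂ (∈-skewCells⁻ {la} {la'} c∈)

    ∈S⁺ : ∀ {i j} → part la' i ≤ j → j < part la i → (i , j) ∈ S
    ∈S⁺ = ∈-skewCells⁺ {la} {la'}

    rowRank-strict : ∀ {i j i'} → (i , j) ∈ S → i < i' → rowRank S i < rowRank S i'
    rowRank-strict c∈ = count-strict (rowOccupied? S) (lose c∈ refl)

    colRank-strict : ∀ {i j j'} → (i , j) ∈ S → j < j' → colRank S j < colRank S j'
    colRank-strict c∈ = count-strict (colOccupied? S) (lose c∈ refl)

    unchanged-or-shorter : ∀ i → part la' i ≡ part la i ⊎ part la' i < part la i
    unchanged-or-shorter i with m≤n⇒m<n∨m≡n (la'⊆la i)
    ... | inj₁ lt = inj₂ lt
    ... | inj₂ eq = inj₁ eq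

  module Horizontal (S≈ : SameCells (compress S) horizontal) where
    private
      relabel∈ : ∀ {s} → s ∈ S → relabel S s ∈ horizontal
      relabel∈ s∈ = Equivalence.to (S≈ _) (∈-compress⁺ {S} s∈)

      rank-row≡0 : ∀ {s} → s ∈ S → rowRank S (proj₁ s) ≡ 0
      rank-row≡0 s∈ with relabel∈ s∈
      ... | here eq         = cong proj₁ eq
      ... | there (here eq) = cong proj₁ eq

      rank-col≤1 : ∀ {s} → s ∈ S → colRank S (proj₂ s) ≤ 1
      rank-col≤1 s∈ with relabel∈ s∈
      ... | here eq         = ≤-trans (≤-reflexive (cong proj₂ eq)) z≤n
      ... | there (here eq) = ≤-reflexive (cong proj₂ eq)

      first : ∃ λ s → s ∈ S × (0 , 0) ≡ relabel S s
      first = ∈-compress⁻ {S} (Equivalence.from (S≈ _) (here refl))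

      r j₀ : ℕ
      r  = proj₁ (proj₁ first)
      j₀ = proj₂ (proj₁ first)

      first∈ : (r , j₀) ∈ S
      first∈ = proj₁ (proj₂ first)

      only-row-r : ∀ {i j} → (i , j) ∈ S → i ≡ r
      only-row-r {i} c∈ with <-cmp i r
      ... | tri< i<r _ _ = ⊥-elim (n≮0 (≤-trans (rowRank-strict c∈ i<r) (≤-reflexive (rank-row≡0 first∈))))
      ... | tri≈ _ i≡r _ = i≡r
      ... | tri> _ _ r<i = ⊥-elim (n≮0 (≤-trans (rowRank-strict first∈ r<i) (≤-reflexive (rank-row≡0 c∈))))

      other-rows : ∀ i → i ≢ r → part la' i ≡ part la i
      other-rows i i≢r with unchanged-or-shorter i
      ... | inj₁ eq = eq
      ... | inj₂ lt = ⊥-elim (i≢r (only-row-r (∈S⁺ ≤-refl lt)))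

      u x : ℕ
      u = part la' r
      x = part la r

      colRank-in-row : ∀ t → u + t ≤ x → colRank S (u + t) ≡ t
      colRank-in-row t u+t≤x =
        trans (count-run (colOccupied? S) u t (λ k u≤k k< → lose (∈S⁺ u≤k (<-≤-trans k< u+t≤x)) refl))
              (cong (_+ t) (count-none (colOccupied? S) u λ k k<u occ → below-u k k<u occ))
        where
        below-u : ∀ k → k < u → ¬ ColOccupied S k
        below-u k k<u occ with find occ
        ... | _ , c∈ , refl with only-row-r c∈
        ... | refl = <-irrefl refl (<-≤-trans k<u (proj₁ (∈S⁻ c∈)))

      u<x : u < x
      u<x = let (u≤ , <x) = ∈S⁻ first∈ in ≤-<-trans u≤ <x

      col≡u : ∀ {j} → (r , j) ∈ S → x ≤ suc u → j ≡ u
      col≡u c∈ x≤ = let (u≤j , j<x) = ∈S⁻ c∈ in ≤-antisym (m<1+n⇒m≤n (≤-trans j<x x≤)) u≤j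

    removal : HorizontalRemoval la la'
    removal = r , length≡2 , other-rows
      where
      length≡2 : u + 2 ≡ x
      -- A longer removed strip would have a third column; a shorter one would put the
      -- cell relabelled (0 , 1) in column u, whose rank is 0.
      length≡2 with <-cmp (u + 2) x
      ... | tri≈ _ eq _ = eq
      ... | tri< u+2<x _ _ = ⊥-elim (1+n≰n (≤-trans (≤-reflexive (sym (colRank-in-row 2 (<⇒≤ u+2<x))))
                                    (rank-col≤1 {r , u + 2} (∈S⁺ (m≤m+n u 2) u+2<x))))
      ... | tri> _ _ x<u+2 with ∈-compress⁻ {S} (Equivalence.from (S≈ _) (there (here refl)))
      ... | (i , j) , c∈ , eq with only-row-r c∈
      ... | refl with col≡u c∈ (m<1+n⇒m≤n (subst (x <_) (+-comm u 2) x<u+2))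
      ... | refl = ⊥-elim (0≢1+n (trans (sym (colRank-in-row 0 (≤-trans (≤-reflexive (+-identityʳ u)) (<⇒≤ u<x))))
                                 (trans (cong (colRank S) (+-identityʳ u)) (sym (cong proj₂ eq)))))

  module Vertical (S≈ : SameCells (compress S) vertical) where
    private
      relabel∈ : ∀ {s} → s ∈ S → relabel S s ∈ vertical
      relabel∈ s∈ = Equivalence.to (S≈ _) (∈-compress⁺ {S} s∈)

      rank-col≡0 : ∀ {s} → s ∈ S → colRank S (proj₂ s) ≡ 0
      rank-col≡0 s∈ with relabel∈ s∈
      ... | here eq         = cong proj₂ eq
      ... | there (here eq) = cong proj₂ eq

      rank-row≤1 : ∀ {s} → s ∈ S → rowRank S (proj₁ s) ≤ 1
      rank-row≤1 s∈ with relabel∈ s∈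
      ... | here eq         = ≤-trans (≤-reflexive (cong proj₁ eq)) z≤n
      ... | there (here eq) = ≤-reflexive (cong proj₁ eq)

      same-col : ∀ {i j i' j'} → (i , j) ∈ S → (i' , j') ∈ S → j ≡ j'
      same-col {j = j} {j' = j'} c∈ c'∈ with <-cmp j j'
      ... | tri< j<j' _ _ = ⊥-elim (n≮0 (≤-trans (colRank-strict c∈ j<j') (≤-reflexive (rank-col≡0 c'∈))))
      ... | tri≈ _ eq _  = eq
      ... | tri> _ _ j'<j = ⊥-elim (n≮0 (≤-trans (colRank-strict c'∈ j'<j) (≤-reflexive (rank-col≡0 c∈))))

      top : ∃ λ s → s ∈ S × (0 , 0) ≡ relabel S s
      top    = ∈-compress⁻ {S} (Equivalence.from (S≈ _) (here refl))
      bottom : ∃ λ s → s ∈ S × (1 , 0) ≡ relabel S s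
      bottom = ∈-compress⁻ {S} (Equivalence.from (S≈ _) (there (here refl)))

      r₀ r₁ j₀ j₁ : ℕ
      r₀ = proj₁ (proj₁ top)
      j₀ = proj₂ (proj₁ top)
      r₁ = proj₁ (proj₁ bottom)
      j₁ = proj₂ (proj₁ bottom)

      top∈ : (r₀ , j₀) ∈ S
      top∈ = proj₁ (proj₂ top)
      bottom∈ : (r₁ , j₁) ∈ S
      bottom∈ = proj₁ (proj₂ bottom)

      rank-r₀ : rowRank S r₀ ≡ 0
      rank-r₀ = sym (cong proj₁ (proj₂ (proj₂ top)))
      rank-r₁ : rowRank S r₁ ≡ 1
      rank-r₁ = sym (cong proj₁ (proj₂ (proj₂ bottom)))

      r₀<r₁ : r₀ < r₁
      r₀<r₁ with <-cmp r₀ r₁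
      ... | tri< lt _ _ = lt
      ... | tri≈ _ eq _ = ⊥-elim (0≢1+n (trans (sym rank-r₀) (trans (cong (rowRank S) eq) rank-r₁)))
      ... | tri> _ _ gt = ⊥-elim (n≮0 (subst₂ _<_ rank-r₁ rank-r₀ (rowRank-strict bottom∈ gt)))

      single-cell : ∀ {i j} → (i , j) ∈ S → part la' i ≡ j × part la i ≡ suc j
      single-cell {i} {j} c∈ = sym (same-col c∈ (∈S⁺ ≤-refl la'<la))
                             , trans (sym 1+[la∸1]) (cong suc (sym (same-col c∈ (∈S⁺ la'≤pred pred<la))))
        where
        la'≤j = proj₁ (∈S⁻ c∈)
        j<la  = proj₂ (∈S⁻ c∈)
        la'<la : part la' i < part la i
        la'<la = ≤-<-trans la'≤j j<la
        1+[la∸1] : suc (part la i ∸ 1) ≡ part la i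
        1+[la∸1] = m+[n∸m]≡n {1} (≤-<-trans z≤n j<la)
        la'≤pred : part la' i ≤ part la i ∸ 1
        la'≤pred = m<1+n⇒m≤n (subst (part la' i <_) (sym 1+[la∸1]) la'<la)
        pred<la : part la i ∸ 1 < part la i
        pred<la = subst (part la i ∸ 1 <_) 1+[la∸1] ≤-refl

      rows-r₀-r₁ : ∀ {i j} → (i , j) ∈ S → i ≡ r₀ ⊎ i ≡ r₁
      rows-r₀-r₁ {i} c∈ with <-cmp i r₀
      ... | tri< i<r₀ _ _ = ⊥-elim (n≮0 (subst (_ <_) rank-r₀ (rowRank-strict c∈ i<r₀)))
      ... | tri≈ _ eq _   = inj₁ eq
      ... | tri> _ _ r₀<i with <-cmp i r₁
      ... | tri< i<r₁ _ _ = ⊥-elim (1+n≰n (≤-trans (s≤s (subst (_< rowRank S i) rank-r₀ (rowRank-strict top∈ r₀<i)))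
                                            (subst (rowRank S i <_) rank-r₁ (rowRank-strict c∈ i<r₁))))
      ... | tri≈ _ eq _   = inj₂ eq
      ... | tri> _ _ r₁<i = ⊥-elim (1+n≰n (≤-trans (subst (_< rowRank S i) rank-r₁ (rowRank-strict bottom∈ r₁<i)) (rank-row≤1 c∈)))

      other-rows : ∀ i → i ≢ r₀ → i ≢ r₁ → part la' i ≡ part la i
      other-rows i i≢r₀ i≢r₁ with unchanged-or-shorter i
      ... | inj₁ eq = eq
      ... | inj₂ lt with rows-r₀-r₁ (∈S⁺ ≤-refl lt)
      ... | inj₁ e = ⊥-elim (i≢r₀ e)
      ... | inj₂ e = ⊥-elim (i≢r₁ e)

      j₀≡j₁ : j₀ ≡ j₁
      j₀≡j₁ = same-col top∈ bottom∈

      -- A row strictly between r₀ and r₁ would be unchanged, yet squeezed between j₀ and j₁ + 1.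
      adjacent : r₁ ≡ suc r₀
      adjacent with <-cmp (suc r₀) r₁
      ... | tri≈ _ eq _ = sym eq
      ... | tri> _ _ gt = ⊥-elim (<-irrefl refl (≤-trans r₀<r₁ (m<1+n⇒m≤n gt)))
      ... | tri< lt _ _ = ⊥-elim (1+n≰n (begin
            suc j₀                  ≡⟨ cong suc j₀≡j₁ ⟩
            suc j₁                  ≡⟨ proj₂ (single-cell bottom∈) ⟨
            part la r₁              ≤⟨ part-antitone pla (<⇒≤ lt) ⟩
            part la (suc r₀)        ≡⟨ other-rows (suc r₀) 1+n≢n (<⇒≢ lt) ⟨
            part la' (suc r₀)       ≤⟨ part-antitone pla' (n≤1+n r₀) ⟩
            part la' r₀             ≡⟨ proj₁ (single-cell top∈) ⟩
            j₀                      ∎))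
        where open ≤-Reasoning

      shortened-by-1 : ∀ {i j} → (i , j) ∈ S → part la' i + 1 ≡ part la i
      shortened-by-1 c∈ = trans (cong (_+ 1) (proj₁ (single-cell c∈))) (trans (+-comm _ 1) (sym (proj₂ (single-cell c∈))))

    removal : VerticalRemoval la la'
    removal = r₀ , shortened-by-1 top∈ , subst (λ i → part la' i + 1 ≡ part la i) adjacent (shortened-by-1 bottom∈)
            , trans (proj₂ (single-cell top∈)) (trans (cong suc j₀≡j₁) (trans (sym (proj₂ (single-cell bottom∈))) (cong (part la) adjacent)))
            , λ i i≢r₀ i≢r₀+1 → other-rows i i≢r₀ (λ e → i≢r₀+1 (trans e adjacent))

dominoRemoval : ∀ {γ la la'} → IsPartition la → γ ∈ dominos → Peel γ la la' → HorizontalRemoval la la' ⊎ VerticalRemoval la la'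
dominoRemoval {la = la} {la'} pla (here refl)         (pla' , la'⊆la , S≈) = inj₁ (DominoRemoval.Horizontal.removal la la' pla pla' la'⊆la S≈)
dominoRemoval {la = la} {la'} pla (there (here refl)) (pla' , la'⊆la , S≈) = inj₂ (DominoRemoval.Vertical.removal la la' pla pla' la'⊆la S≈)

parity : ℕ → ℤ
parity zero          = pos 0
parity (suc zero)    = pos 1
parity (suc (suc n)) = parity n

alternatingParity : List ℕ → ℤ
alternatingParity []       = pos 0
alternatingParity (x ∷ xs) = parity x -ℤ alternatingParity xs

private
  x-[x-y]≡y : ∀ x y → x -ℤ (x -ℤ y) ≡ y
  x-[x-y]≡y = solve-∀

parity-+2 : ∀ n → parity (n + 2) ≡ parity n
parity-+2 n = cong parity (+-comm n 2)

Positive : List ℕ → Set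
Positive = All (0 <_)

part-injective : ∀ {l l'} → Positive l → Positive l' → (∀ i → part l i ≡ part l' i) → l ≡ l'
part-injective {[]}    {[]}     _        _          _  = refl
part-injective {[]}    {y ∷ l'} _        (y>0 ∷ _)  eq = ⊥-elim (<-irrefl (eq 0) y>0)
part-injective {x ∷ l} {[]}     (x>0 ∷ _) _         eq = ⊥-elim (<-irrefl (sym (eq 0)) x>0)
part-injective {x ∷ l} {y ∷ l'} (_ ∷ ps) (_ ∷ ps')  eq = cong₂ _∷_ (eq 0) (part-injective ps ps' (λ i → eq (suc i)))

alternatingParity-horizontal : ∀ l l' r → Positive l → Positive l' → part l' r + 2 ≡ part l r →
  (∀ i → i ≢ r → part l' i ≡ part l i) → alternatingParity l' ≡ alternatingParity l
alternatingParity-horizontal [] l' r _ _ e _ = ⊥-elim (0≢1+n (sym (trans (+-comm 2 _) e)))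
alternatingParity-horizontal (x ∷ xs) [] zero (_ ∷ ps) _ e same with part-injective ps [] (λ i → sym (same (suc i) (λ ())))
... | refl with e
... | refl = refl
alternatingParity-horizontal (x ∷ xs) (x' ∷ xs') zero (_ ∷ ps) (_ ∷ ps') refl same
  with part-injective ps' ps (λ i → same (suc i) (λ ()))
... | refl = cong (_-ℤ alternatingParity xs) (sym (parity-+2 x'))
alternatingParity-horizontal (x ∷ xs) [] (suc r) (x>0 ∷ _) _ _ same = ⊥-elim (<-irrefl (same 0 (λ ())) x>0)
alternatingParity-horizontal (x ∷ xs) (x' ∷ xs') (suc r) (_ ∷ ps) (_ ∷ ps') e same =
  cong₂ _-ℤ_ (cong parity (same 0 (λ ())))
             (alternatingParity-horizontal xs xs' r ps ps' e (λ i i≢r → same (suc i) (i≢r ∘ suc-injective)))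

-- Lowering two equal rows by one flips both parities, which cancel in the alternating sum.
alternatingParity-vertical : ∀ l l' r → Positive l → Positive l' → part l' r + 1 ≡ part l r →
  part l' (suc r) + 1 ≡ part l (suc r) → part l r ≡ part l (suc r) →
  (∀ i → i ≢ r → i ≢ suc r → part l' i ≡ part l i) → alternatingParity l' ≡ alternatingParity l
alternatingParity-vertical [] l' r _ _ e _ _ _ = ⊥-elim (0≢1+n (sym (trans (+-comm 1 _) e)))
alternatingParity-vertical (x ∷ []) l' zero _ _ _ e _ _ = ⊥-elim (0≢1+n (sym (trans (+-comm 1 _) e)))
alternatingParity-vertical (x ∷ y ∷ xs) [] zero (_ ∷ _ ∷ ps) _ e₀ e₁ _ same
  with part-injective ps [] (λ i → sym (same (suc (suc i)) (λ ()) (λ ())))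
... | refl with e₀ | e₁
... | refl | refl = refl
alternatingParity-vertical (x ∷ y ∷ xs) (x' ∷ []) zero _ (x'>0 ∷ _) e₀ e₁ x≡y _ =
  ⊥-elim (<-irrefl (sym (+-cancelʳ-≡ 1 x' 0 (trans e₀ (trans x≡y (sym e₁))))) x'>0)
alternatingParity-vertical (x ∷ y ∷ xs) (x' ∷ y' ∷ xs') zero (_ ∷ _ ∷ ps) (_ ∷ _ ∷ ps') e₀ e₁ x≡y same
  with part-injective ps' ps (λ i → same (suc (suc i)) (λ ()) (λ ()))
... | refl = begin
    parity x' -ℤ (parity y' -ℤ alternatingParity xs) ≡⟨ cong (λ z → parity x' -ℤ (parity z -ℤ _)) y'≡x' ⟩
    parity x' -ℤ (parity x' -ℤ alternatingParity xs) ≡⟨ x-[x-y]≡y (parity x') _ ⟩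
    alternatingParity xs                             ≡⟨ x-[x-y]≡y (parity x) _ ⟨
    parity x -ℤ (parity x -ℤ alternatingParity xs)   ≡⟨ cong (λ z → parity x -ℤ (parity z -ℤ _)) x≡y ⟩
    parity x -ℤ (parity y -ℤ alternatingParity xs)   ∎
  where
  open ≡-Reasoning
  y'≡x' : y' ≡ x'
  y'≡x' = +-cancelʳ-≡ 1 y' x' (trans e₁ (trans (sym x≡y) (sym e₀)))
alternatingParity-vertical (x ∷ xs) [] (suc r) (x>0 ∷ _) _ _ _ _ same = ⊥-elim (<-irrefl (same 0 (λ ()) (λ ())) x>0)
alternatingParity-vertical (x ∷ xs) (x' ∷ xs') (suc r) (_ ∷ ps) (_ ∷ ps') e₀ e₁ x≡y same =
  cong₂ _-ℤ_ (cong parity (same 0 (λ ()) (λ ())))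
             (alternatingParity-vertical xs xs' r ps ps' e₀ e₁ x≡y (λ i ≢r ≢r+1 → same (suc i) (≢r ∘ suc-injective) (≢r+1 ∘ suc-injective)))

PeelSeq-isPartition : ∀ {F la n mu} → PeelSeq F la n mu → IsPartition la → IsPartition mu
PeelSeq-isPartition done                      pla = pla
PeelSeq-isPartition (step _ _ (pla' , _) seq) _   = PeelSeq-isPartition seq pla'

PeelSeq-snoc : ∀ {F la n mu mu'} γ → γ ∈ F → PeelSeq F la n mu → Peel γ mu mu' → PeelSeq F la (suc n) mu'
PeelSeq-snoc γ γ∈ done                 p = step γ γ∈ p done
PeelSeq-snoc γ γ∈ (step γ' γ'∈ p' seq) p = step γ' γ'∈ p' (PeelSeq-snoc γ γ∈ seq p)

alternatingParity-dominoSeq : ∀ {la n mu} → PeelSeq dominos la n mu → IsPartition la → alternatingParity mu ≡ alternatingParity la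
alternatingParity-dominoSeq done _ = refl
alternatingParity-dominoSeq {la} (step {la' = la'} γ γ∈ p seq) pla with dominoRemoval pla γ∈ p
... | inj₁ (r , e , same) = trans (alternatingParity-dominoSeq seq (proj₁ p))
      (alternatingParity-horizontal la la' r (proj₂ pla) (proj₂ (proj₁ p)) e same)
... | inj₂ (r , e₀ , e₁ , x≡y , same) = trans (alternatingParity-dominoSeq seq (proj₁ p))
      (alternatingParity-vertical la la' r (proj₂ pla) (proj₂ (proj₁ p)) e₀ e₁ x≡y same)

-- Staircases and domino peelings

staircase : ℕ → List ℕ
staircase zero    = []
staircase (suc n) = suc n ∷ staircase n

part-staircase : ∀ n i → part (staircase n) i ≡ n ∸ i
part-staircase zero    zero    = refl
part-staircase zero    (suc i) = refl
part-staircase (suc n) zero    = refl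
part-staircase (suc n) (suc i) = part-staircase n i

HorizontalAt : List ℕ → ℕ → Set
HorizontalAt l r = part l (suc r) + 2 ≤ part l r

VerticalAt : List ℕ → ℕ → Set
VerticalAt l r = part l r ≡ part l (suc r) × part l (suc (suc r)) < part l (suc r)

DominoPeelable : List ℕ → Set
DominoPeelable l = (∃ λ r → HorizontalAt l r) ⊎ (∃ λ r → VerticalAt l r)

staircase-or-dominoPeelable : ∀ l → IsPartition l → (∃ λ n → l ≡ staircase n) ⊎ DominoPeelable l
staircase-or-dominoPeelable []       _  = inj₁ (0 , refl)
staircase-or-dominoPeelable (x ∷ xs) pl with staircase-or-dominoPeelable xs (IsPartition-tail pl)
... | inj₂ (inj₁ (r , h)) = inj₂ (inj₁ (suc r , h))
... | inj₂ (inj₂ (r , v)) = inj₂ (inj₂ (suc r , v))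
... | inj₁ (n , refl) with <-cmp x (suc n)
... | tri≈ _ refl _ = inj₁ (suc n , refl)
... | tri> _ _ gt  = inj₂ (inj₁ (0 , subst (_≤ x) (sym (trans (cong (_+ 2) (part-staircase n 0)) (+-comm n 2))) gt))
... | tri< lt _ _ with ≤-antisym (m<1+n⇒m≤n lt) (subst (_≤ x) (part-staircase n 0) (part-suc≤part pl 0))
... | refl with n
... | zero  = ⊥-elim (<-irrefl refl (IsPartition-head>0 pl))
... | suc m = inj₂ (inj₂ (0 , refl , subst (_< suc m) (sym (part-staircase m 0)) ≤-refl))

lowerRow : (ℕ → ℕ) → ℕ → ℕ → ℕ
lowerRow f zero    zero    = f 0 ∸ 2
lowerRow f zero    (suc i) = f (suc i)
lowerRow f (suc r) zero    = f 0
lowerRow f (suc r) (suc i) = lowerRow (f ∘ suc) r i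

lowerRow-at : ∀ f r → lowerRow f r r ≡ f r ∸ 2
lowerRow-at f zero    = refl
lowerRow-at f (suc r) = lowerRow-at (f ∘ suc) r

lowerRow-off : ∀ f r i → i ≢ r → lowerRow f r i ≡ f i
lowerRow-off f zero    zero    i≢r = ⊥-elim (i≢r refl)
lowerRow-off f zero    (suc i) _   = refl
lowerRow-off f (suc r) zero    _   = refl
lowerRow-off f (suc r) (suc i) i≢r = lowerRow-off (f ∘ suc) r i (i≢r ∘ cong suc)

lowerTwoRows : (ℕ → ℕ) → ℕ → ℕ → ℕ
lowerTwoRows f zero    zero          = f 0 ∸ 1
lowerTwoRows f zero    (suc zero)    = f 1 ∸ 1
lowerTwoRows f zero    (suc (suc i)) = f (suc (suc i))
lowerTwoRows f (suc r) zero          = f 0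
lowerTwoRows f (suc r) (suc i)       = lowerTwoRows (f ∘ suc) r i

lowerTwoRows-at : ∀ f r → lowerTwoRows f r r ≡ f r ∸ 1
lowerTwoRows-at f zero    = refl
lowerTwoRows-at f (suc r) = lowerTwoRows-at (f ∘ suc) r

lowerTwoRows-at-suc : ∀ f r → lowerTwoRows f r (suc r) ≡ f (suc r) ∸ 1
lowerTwoRows-at-suc f zero    = refl
lowerTwoRows-at-suc f (suc r) = lowerTwoRows-at-suc (f ∘ suc) r

lowerTwoRows-off : ∀ f r i → i ≢ r → i ≢ suc r → lowerTwoRows f r i ≡ f i
lowerTwoRows-off f zero    zero          ≢r _     = ⊥-elim (≢r refl)
lowerTwoRows-off f zero    (suc zero)    _  ≢r+1  = ⊥-elim (≢r+1 refl)
lowerTwoRows-off f zero    (suc (suc i)) _  _     = refl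
lowerTwoRows-off f (suc r) zero          _  _     = refl
lowerTwoRows-off f (suc r) (suc i)       ≢r ≢r+1  = lowerTwoRows-off (f ∘ suc) r i (≢r ∘ cong suc) (≢r+1 ∘ cong suc)

among-last-two : ∀ x j → 2 ≤ x → x ∸ 2 ≤ j → j < x → j ≡ x ∸ 2 ⊎ j ≡ x ∸ 1
among-last-two (suc zero)    j (s≤s ()) _ _
among-last-two (suc (suc y)) j _ y≤j j<x with m≤n⇒m<n∨m≡n y≤j
... | inj₂ eq = inj₁ (sym eq)
... | inj₁ lt = inj₂ (≤-antisym (m<1+n⇒m≤n j<x) lt)

the-last : ∀ x j → x ∸ 1 ≤ j → j < x → j ≡ x ∸ 1
the-last (suc y) j y≤j j<x = ≤-antisym (m<1+n⇒m≤n j<x) y≤j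

x∸2<x∸1 : ∀ x → 2 ≤ x → x ∸ 2 < x ∸ 1
x∸2<x∸1 (suc zero)    (s≤s ())
x∸2<x∸1 (suc (suc y)) _ = ≤-refl

x∸1<x : ∀ x → 1 ≤ x → x ∸ 1 < x
x∸1<x (suc y) _ = ≤-refl

x∸2<x : ∀ x → 2 ≤ x → x ∸ 2 < x
x∸2<x x 2≤x = <-trans (x∸2<x∸1 x 2≤x) (x∸1<x x (≤-trans (s≤s z≤n) 2≤x))

<⇒≤∸1 : ∀ {a b} → a < b → a ≤ b ∸ 1
<⇒≤∸1 {b = suc b} (s≤s a≤b) = a≤b

module HorizontalProfile (f : ℕ → ℕ) (f-dec : Decreasing f) (r : ℕ) (hr : f (suc r) + 2 ≤ f r) where
  g : ℕ → ℕ
  g = lowerRow f r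

  x : ℕ
  x = f r

  2≤x : 2 ≤ x
  2≤x = ≤-trans (m≤n+m 2 _) hr

  g≤f : ∀ i → g i ≤ f i
  g≤f i with i ≟ r
  ... | yes refl = subst (_≤ f r) (sym (lowerRow-at f r)) (m∸n≤m (f r) 2)
  ... | no i≢r   = ≤-reflexive (lowerRow-off f r i i≢r)

  g-dec : Decreasing g
  g-dec i with i ≟ r | suc i ≟ r
  ... | yes refl | _ = subst₂ _≤_ (sym (lowerRow-off f r (suc r) 1+n≢n)) (sym (lowerRow-at f r))
                         (subst (_≤ f r ∸ 2) (m+n∸n≡m (f (suc r)) 2) (∸-monoˡ-≤ 2 hr))
  ... | no i≢r | yes refl = subst₂ _≤_ (sym (lowerRow-at f (suc i))) (sym (lowerRow-off f (suc i) i i≢r))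
                              (≤-trans (m∸n≤m _ 2) (f-dec i))
  ... | no i≢r | no i+1≢r = subst₂ _≤_ (sym (lowerRow-off f r (suc i) i+1≢r)) (sym (lowerRow-off f r i i≢r)) (f-dec i)

  removed : ∀ i j → g i ≤ j → j < f i → i ≡ r × (j ≡ x ∸ 2 ⊎ j ≡ x ∸ 1)
  removed i j g≤j j<f with i ≟ r
  ... | no i≢r   = ⊥-elim (<-irrefl refl (≤-trans j<f (subst (_≤ j) (lowerRow-off f r i i≢r) g≤j)))
  ... | yes refl = refl , among-last-two x j 2≤x (subst (_≤ j) (lowerRow-at f r) g≤j) j<f

  g≤x∸2 : g r ≤ x ∸ 2
  g≤x∸2 = ≤-reflexive (lowerRow-at f r)

  g≤x∸1 : g r ≤ x ∸ 1
  g≤x∸1 = ≤-trans g≤x∸2 (<⇒≤ (x∸2<x∸1 x 2≤x))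

module VerticalProfile (f : ℕ → ℕ) (f-dec : Decreasing f) (r : ℕ)
  (hv : f r ≡ f (suc r)) (hl : f (suc (suc r)) < f (suc r)) where
  g : ℕ → ℕ
  g = lowerTwoRows f r

  x : ℕ
  x = f r

  1≤x : 1 ≤ x
  1≤x = ≤-trans (s≤s z≤n) (subst (f (suc (suc r)) <_) (sym hv) hl)

  g≤f : ∀ i → g i ≤ f i
  g≤f i with i ≟ r | i ≟ suc r
  ... | yes refl | _        = subst (_≤ f r) (sym (lowerTwoRows-at f r)) (m∸n≤m _ 1)
  ... | no _     | yes refl = subst (_≤ f (suc r)) (sym (lowerTwoRows-at-suc f r)) (m∸n≤m _ 1)
  ... | no ≢r    | no ≢r+1  = ≤-reflexive (lowerTwoRows-off f r i ≢r ≢r+1)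

  g-dec : Decreasing g
  g-dec i with i ≟ r | i ≟ suc r | suc i ≟ r
  ... | yes refl | _ | _ = subst₂ _≤_ (sym (lowerTwoRows-at-suc f r)) (sym (lowerTwoRows-at f r)) (≤-reflexive (cong (_∸ 1) (sym hv)))
  ... | no _ | yes refl | _ = subst₂ _≤_ (sym (lowerTwoRows-off f r (suc (suc r)) (λ e → <-irrefl (sym e) (<-trans (n<1+n r) (n<1+n (suc r)))) 1+n≢n))
                                  (sym (lowerTwoRows-at-suc f r)) (<⇒≤∸1 hl)
  ... | no ≢r | no ≢r+1 | yes refl = subst₂ _≤_ (sym (lowerTwoRows-at f (suc i))) (sym (lowerTwoRows-off f (suc i) i ≢r ≢r+1))
                                        (≤-trans (m∸n≤m _ 1) (f-dec i))
  ... | no ≢r | no ≢r+1 | no i+1≢r = subst₂ _≤_ (sym (lowerTwoRows-off f r (suc i) i+1≢r (≢r ∘ suc-injective)))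
                                        (sym (lowerTwoRows-off f r i ≢r ≢r+1)) (f-dec i)

  removed : ∀ i j → g i ≤ j → j < f i → (i ≡ r ⊎ i ≡ suc r) × j ≡ x ∸ 1
  removed i j g≤j j<f with i ≟ r | i ≟ suc r
  ... | yes refl | _        = inj₁ refl , the-last x j (subst (_≤ j) (lowerTwoRows-at f r) g≤j) j<f
  ... | no _     | yes refl = inj₂ refl , trans (the-last (f (suc r)) j (subst (_≤ j) (lowerTwoRows-at-suc f r) g≤j) j<f)
                                                 (cong (_∸ 1) (sym hv))
  ... | no ≢r    | no ≢r+1  = ⊥-elim (<-irrefl refl (≤-trans j<f (subst (_≤ j) (lowerTwoRows-off f r i ≢r ≢r+1) g≤j)))

  g≤x∸1 : g r ≤ x ∸ 1
  g≤x∸1 = ≤-reflexive (lowerTwoRows-at f r)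

  g-suc≤x∸1 : g (suc r) ≤ x ∸ 1
  g-suc≤x∸1 = ≤-reflexive (trans (lowerTwoRows-at-suc f r) (cong (_∸ 1) (sym hv)))

  x∸1<f-suc : x ∸ 1 < f (suc r)
  x∸1<f-suc = subst (x ∸ 1 <_) hv (x∸1<x x 1≤x)

peel-horizontal : ∀ l → IsPartition l → ∀ r → HorizontalAt l r → ∃ λ l' → Peel horizontal l l'
peel-horizontal l pl r hr = PeelByEmbedding.peel l g H.g-dec H.g≤f horizontal 1 2
  (toWitness {a? = spans? horizontal 1 2} tt) (λ _ → r) C (λ _ → λ { (s≤s ()) }) C-step onto into
  where
  module H = HorizontalProfile (part l) (part-suc≤part pl) r hr
  open H using (g; x)
  C : ℕ → ℕ
  C zero    = x ∸ 2
  C (suc _) = x ∸ 1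
  C-step : ∀ b → suc b < 2 → C b < C (suc b)
  C-step zero    _ = x∸2<x∸1 x H.2≤x
  C-step (suc b) (s≤s (s≤s ()))
  onto : ∀ i j → g i ≤ j → j < part l i → ∃ λ e → e ∈ horizontal × i ≡ r × j ≡ C (proj₂ e)
  onto i j g≤j j<l with H.removed i j g≤j j<l
  ... | refl , inj₁ refl = _ , here refl , refl , refl
  ... | refl , inj₂ refl = _ , there (here refl) , refl , refl
  into : ∀ e → e ∈ horizontal → g r ≤ C (proj₂ e) × C (proj₂ e) < part l r
  into _ (here refl)         = H.g≤x∸2 , x∸2<x x H.2≤x
  into _ (there (here refl)) = H.g≤x∸1 , x∸1<x x (≤-trans (s≤s z≤n) H.2≤x)

peel-vertical : ∀ l → IsPartition l → ∀ r → VerticalAt l r → ∃ λ l' → Peel vertical l l'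
peel-vertical l pl r (hv , hl) = PeelByEmbedding.peel l g V.g-dec V.g≤f vertical 2 1
  (toWitness {a? = spans? vertical 2 1} tt) R (λ _ → x ∸ 1) R-step (λ _ → λ { (s≤s ()) }) onto into
  where
  module V = VerticalProfile (part l) (part-suc≤part pl) r hv hl
  open V using (g; x)
  R : ℕ → ℕ
  R zero    = r
  R (suc _) = suc r
  R-step : ∀ a → suc a < 2 → R a < R (suc a)
  R-step zero    _ = n<1+n r
  R-step (suc a) (s≤s (s≤s ()))
  onto : ∀ i j → g i ≤ j → j < part l i → ∃ λ e → e ∈ vertical × i ≡ R (proj₁ e) × j ≡ x ∸ 1
  onto i j g≤j j<l with V.removed i j g≤j j<l
  ... | inj₁ refl , refl = _ , here refl , refl , refl
  ... | inj₂ refl , refl = _ , there (here refl) , refl , refl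
  into : ∀ e → e ∈ vertical → g (R (proj₁ e)) ≤ x ∸ 1 × x ∸ 1 < part l (R (proj₁ e))
  into _ (here refl)         = V.g≤x∸1 , x∸1<x x V.1≤x
  into _ (there (here refl)) = V.g-suc≤x∸1 , V.x∸1<f-suc

maxPeel-stuck : ∀ {F la d mu γ} → MaxPeel F la d → PeelSeq F la d mu → γ ∈ F → ¬ (∃ λ mu' → Peel γ mu mu')
maxPeel-stuck {γ = γ} (_ , maximal) seq γ∈ (_ , p) = 1+n≰n (maximal _ _ (PeelSeq-snoc γ γ∈ seq p))

staircaseOf-isStaircase : ∀ la mu → IsPartition la → StaircaseOf la mu → ∃ λ n → mu ≡ staircase n
staircaseOf-isStaircase la mu pla (_ , max , seq) with staircase-or-dominoPeelable mu (PeelSeq-isPartition seq pla)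
... | inj₁ isStaircase     = isStaircase
... | inj₂ (inj₁ (r , hr)) = ⊥-elim (maxPeel-stuck max seq (here refl) (peel-horizontal mu (PeelSeq-isPartition seq pla) r hr))
... | inj₂ (inj₂ (r , vr)) = ⊥-elim (maxPeel-stuck max seq (there (here refl)) (peel-vertical mu (PeelSeq-isPartition seq pla) r vr))

-- Tetromino peelings

fourInRow square zigzag hook pairHH pairVV pairHV pairVH : List Cell
fourInRow = (0 , 0) ∷ (0 , 1) ∷ (0 , 2) ∷ (0 , 3) ∷ []
square    = (0 , 0) ∷ (0 , 1) ∷ (1 , 0) ∷ (1 , 1) ∷ []
zigzag    = (0 , 1) ∷ (1 , 0) ∷ (1 , 1) ∷ (2 , 0) ∷ []
hook      = (0 , 0) ∷ (0 , 1) ∷ (0 , 2) ∷ (1 , 0) ∷ []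
pairHH    = (0 , 2) ∷ (0 , 3) ∷ (1 , 0) ∷ (1 , 1) ∷ []
pairVV    = (0 , 1) ∷ (1 , 1) ∷ (2 , 0) ∷ (3 , 0) ∷ []
pairHV    = (0 , 1) ∷ (0 , 2) ∷ (1 , 0) ∷ (2 , 0) ∷ []
pairVH    = (0 , 2) ∷ (1 , 2) ∷ (2 , 0) ∷ (2 , 1) ∷ []

within₁ : ∀ {m j} → m ≤ j → j < suc m → j ≡ m
within₁ m≤j j<1+m = ≤-antisym (m<1+n⇒m≤n j<1+m) m≤j

within₂ : ∀ {m j} → m ≤ j → j < 2 + m → j ≡ m ⊎ j ≡ suc m
within₂ m≤j j< with m≤n⇒m<n∨m≡n m≤j
... | inj₂ eq = inj₁ (sym eq)
... | inj₁ lt = inj₂ (within₁ lt j<)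

within₃ : ∀ {m j} → m ≤ j → j < 3 + m → j ≡ m ⊎ j ≡ suc m ⊎ j ≡ 2 + m
within₃ m≤j j< with m≤n⇒m<n∨m≡n m≤j
... | inj₂ eq = inj₁ (sym eq)
... | inj₁ lt = inj₂ (within₂ lt j<)

peel-fourInRow : ∀ a l → IsPartition (a ∷ l) → part l 0 + 4 ≤ a → ∃ λ la' → Peel fourInRow (a ∷ l) la'
peel-fourInRow a l pal l+4≤a = PeelByEmbedding.peel (a ∷ l) g g-dec g≤ fourInRow 1 4
  (toWitness {a? = spans? fourInRow 1 4} tt) (λ _ → 0) ((a ∸ 4) +_)
  (λ _ → λ { (s≤s ()) }) (λ b _ → +-monoʳ-< (a ∸ 4) (n<1+n b)) onto into
  where
  4≤a : 4 ≤ a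
  4≤a = ≤-trans (m≤n+m 4 _) l+4≤a
  g : ℕ → ℕ
  g zero    = a ∸ 4
  g (suc i) = part l i
  g-dec : Decreasing g
  g-dec zero    = subst (_≤ a ∸ 4) (m+n∸n≡m (part l 0) 4) (∸-monoˡ-≤ 4 l+4≤a)
  g-dec (suc i) = part-suc≤part (IsPartition-tail pal) i
  g≤ : ∀ i → g i ≤ part (a ∷ l) i
  g≤ zero    = m∸n≤m a 4
  g≤ (suc i) = ≤-refl
  onto : ∀ i j → g i ≤ j → j < part (a ∷ l) i → ∃ λ e → e ∈ fourInRow × i ≡ 0 × j ≡ (a ∸ 4) + proj₂ e
  onto (suc i) j g≤j j<l = ⊥-elim (≤⇒≯ g≤j j<l)
  onto zero    j g≤j j<a with j ∸ (a ∸ 4) | m+[n∸m]≡n g≤j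
  ... | 0 | j≡ = _ , here refl , refl , sym j≡
  ... | 1 | j≡ = _ , there (here refl) , refl , sym j≡
  ... | 2 | j≡ = _ , there (there (here refl)) , refl , sym j≡
  ... | 3 | j≡ = _ , there (there (there (here refl))) , refl , sym j≡
  ... | suc (suc (suc (suc _))) | j≡ = ⊥-elim (<-irrefl refl (begin-strict
        (a ∸ 4) + 4 ≤⟨ +-monoʳ-≤ (a ∸ 4) (s≤s (s≤s (s≤s (s≤s z≤n)))) ⟩
        (a ∸ 4) + _ ≡⟨ j≡ ⟩
        j           <⟨ j<a ⟩
        a           ≡⟨ m∸n+n≡m 4≤a ⟨
        (a ∸ 4) + 4 ∎))
    where open ≤-Reasoning
  into : ∀ e → e ∈ fourInRow → g 0 ≤ (a ∸ 4) + proj₂ e × (a ∸ 4) + proj₂ e < a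
  into e e∈ = m≤m+n _ _ , subst ((a ∸ 4) + proj₂ e <_) (m∸n+n≡m 4≤a) (+-monoʳ-< (a ∸ 4) (col<4 e∈))
    where
    col<4 : ∀ {e} → e ∈ fourInRow → proj₂ e < 4
    col<4 = All.lookup (proj₁ (proj₂ (proj₂ (toWitness {a? = spans? fourInRow 1 4} tt))))

pairCol : ℕ → ℕ → ℕ
pairCol k zero    = k
pairCol k (suc _) = suc k

peel-square : ∀ k l → IsPartition (2 + k ∷ 2 + k ∷ l) → part l 0 ≤ k → ∃ λ la' → Peel square (2 + k ∷ 2 + k ∷ l) la'
peel-square k l pal l≤k = PeelByEmbedding.peel la g g-dec g≤ square 2 2
  (toWitness {a? = spans? square 2 2} tt) (λ a → a) (pairCol k)
  (λ { zero _ → s≤s z≤n ; (suc a) (s≤s (s≤s ())) }) (λ { zero _ → n<1+n k ; (suc b) (s≤s (s≤s ())) }) onto into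
  where
  la = 2 + k ∷ 2 + k ∷ l
  g : ℕ → ℕ
  g zero          = k
  g (suc zero)    = k
  g (suc (suc i)) = part l i
  g-dec : Decreasing g
  g-dec zero          = ≤-refl
  g-dec (suc zero)    = l≤k
  g-dec (suc (suc i)) = part-suc≤part (IsPartition-tail (IsPartition-tail pal)) i
  g≤ : ∀ i → g i ≤ part la i
  g≤ zero          = m≤n+m k 2
  g≤ (suc zero)    = m≤n+m k 2
  g≤ (suc (suc i)) = ≤-refl
  onto : ∀ i j → g i ≤ j → j < part la i → ∃ λ e → e ∈ square × i ≡ proj₁ e × j ≡ pairCol k (proj₂ e)
  onto zero j k≤j j< with within₂ k≤j j<
  ... | inj₁ refl = _ , here refl , refl , refl
  ... | inj₂ refl = _ , there (here refl) , refl , refl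
  onto (suc zero) j k≤j j< with within₂ k≤j j<
  ... | inj₁ refl = _ , there (there (here refl)) , refl , refl
  ... | inj₂ refl = _ , there (there (there (here refl))) , refl , refl
  onto (suc (suc i)) j g≤j j<l = ⊥-elim (≤⇒≯ g≤j j<l)
  into : ∀ e → e ∈ square → g (proj₁ e) ≤ pairCol k (proj₂ e) × pairCol k (proj₂ e) < part la (proj₁ e)
  into _ (here refl)                         = ≤-refl , m<n+m k (s≤s z≤n)
  into _ (there (here refl))                 = n≤1+n k , ≤-refl
  into _ (there (there (here refl)))         = ≤-refl , m<n+m k (s≤s z≤n)
  into _ (there (there (there (here refl)))) = n≤1+n k , ≤-refl

peel-zigzag : ∀ k l → IsPartition (2 + k ∷ 2 + k ∷ suc k ∷ l) → part l 0 ≤ k → ∃ λ la' → Peel zigzag (2 + k ∷ 2 + k ∷ suc k ∷ l) la'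
peel-zigzag k l pal l≤k = PeelByEmbedding.peel la g g-dec g≤ zigzag 3 2
  (toWitness {a? = spans? zigzag 3 2} tt) (λ a → a) (pairCol k)
  (λ { zero _ → s≤s z≤n ; (suc zero) _ → s≤s (s≤s z≤n) ; (suc (suc a)) (s≤s (s≤s (s≤s ()))) })
  (λ { zero _ → n<1+n k ; (suc b) (s≤s (s≤s ())) }) onto into
  where
  la = 2 + k ∷ 2 + k ∷ suc k ∷ l
  g : ℕ → ℕ
  g zero                = suc k
  g (suc zero)          = k
  g (suc (suc zero))    = k
  g (suc (suc (suc i))) = part l i
  g-dec : Decreasing g
  g-dec zero                = n≤1+n k
  g-dec (suc zero)          = ≤-refl
  g-dec (suc (suc zero))    = l≤k
  g-dec (suc (suc (suc i))) = part-suc≤part (IsPartition-tail (IsPartition-tail (IsPartition-tail pal))) i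
  g≤ : ∀ i → g i ≤ part la i
  g≤ zero                = n≤1+n (suc k)
  g≤ (suc zero)          = m≤n+m k 2
  g≤ (suc (suc zero))    = n≤1+n k
  g≤ (suc (suc (suc i))) = ≤-refl
  onto : ∀ i j → g i ≤ j → j < part la i → ∃ λ e → e ∈ zigzag × i ≡ proj₁ e × j ≡ pairCol k (proj₂ e)
  onto zero j g≤j j< with within₁ g≤j j<
  ... | refl = _ , here refl , refl , refl
  onto (suc zero) j k≤j j< with within₂ k≤j j<
  ... | inj₁ refl = _ , there (here refl) , refl , refl
  ... | inj₂ refl = _ , there (there (here refl)) , refl , refl
  onto (suc (suc zero)) j k≤j j< with within₁ k≤j j<
  ... | refl = _ , there (there (there (here refl))) , refl , refl
  onto (suc (suc (suc i))) j g≤j j<l = ⊥-elim (≤⇒≯ g≤j j<l)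
  into : ∀ e → e ∈ zigzag → g (proj₁ e) ≤ pairCol k (proj₂ e) × pairCol k (proj₂ e) < part la (proj₁ e)
  into _ (here refl)                         = ≤-refl , ≤-refl
  into _ (there (here refl))                 = ≤-refl , m<n+m k (s≤s z≤n)
  into _ (there (there (here refl)))         = n≤1+n k , ≤-refl
  into _ (there (there (there (here refl)))) = ≤-refl , ≤-refl

hookCol : ℕ → ℕ → ℕ
hookCol m zero          = m
hookCol m (suc zero)    = suc m
hookCol m (suc (suc _)) = 2 + m

peel-hook : ∀ m l → IsPartition (3 + m ∷ suc m ∷ l) → part l 0 ≤ m → ∃ λ la' → Peel hook (3 + m ∷ suc m ∷ l) la'
peel-hook m l pal l≤m = PeelByEmbedding.peel la g g-dec g≤ hook 2 3
  (toWitness {a? = spans? hook 2 3} tt) (λ a → a) (hookCol m)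
  (λ { zero _ → s≤s z≤n ; (suc a) (s≤s (s≤s ())) })
  (λ { zero _ → ≤-refl ; (suc zero) _ → ≤-refl ; (suc (suc b)) (s≤s (s≤s (s≤s ()))) }) onto into
  where
  la = 3 + m ∷ suc m ∷ l
  g : ℕ → ℕ
  g zero          = m
  g (suc zero)    = m
  g (suc (suc i)) = part l i
  g-dec : Decreasing g
  g-dec zero          = ≤-refl
  g-dec (suc zero)    = l≤m
  g-dec (suc (suc i)) = part-suc≤part (IsPartition-tail (IsPartition-tail pal)) i
  g≤ : ∀ i → g i ≤ part la i
  g≤ zero          = m≤n+m m 3
  g≤ (suc zero)    = n≤1+n m
  g≤ (suc (suc i)) = ≤-refl
  onto : ∀ i j → g i ≤ j → j < part la i → ∃ λ e → e ∈ hook × i ≡ proj₁ e × j ≡ hookCol m (proj₂ e)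
  onto zero j m≤j j< with within₃ m≤j j<
  ... | inj₁ refl        = _ , here refl , refl , refl
  ... | inj₂ (inj₁ refl) = _ , there (here refl) , refl , refl
  ... | inj₂ (inj₂ refl) = _ , there (there (here refl)) , refl , refl
  onto (suc zero) j m≤j j< with within₁ m≤j j<
  ... | refl = _ , there (there (there (here refl))) , refl , refl
  onto (suc (suc i)) j g≤j j<l = ⊥-elim (≤⇒≯ g≤j j<l)
  into : ∀ e → e ∈ hook → g (proj₁ e) ≤ hookCol m (proj₂ e) × hookCol m (proj₂ e) < part la (proj₁ e)
  into _ (here refl)                         = ≤-refl , m<n+m m (s≤s z≤n)
  into _ (there (here refl))                 = n≤1+n m , n≤1+n (2 + m)
  into _ (there (there (here refl)))         = m≤n+m m 2 , ≤-refl
  into _ (there (there (there (here refl)))) = ≤-refl , ≤-refl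

x∸1<a∸2 : ∀ x a → 1 ≤ x → x + 2 ≤ a → x ∸ 1 < a ∸ 2
x∸1<a∸2 (suc y) a _ y+3≤a = subst (_≤ a ∸ 2) (m+n∸n≡m (suc y) 2) (∸-monoˡ-≤ 2 y+3≤a)

module TopRowMinus2 (a : ℕ) (l : List ℕ) (g' : ℕ → ℕ) (g'-dec : Decreasing g')
  (g'≤ : ∀ i → g' i ≤ part l i) (l+2≤a : part l 0 + 2 ≤ a) where
  g : ℕ → ℕ
  g zero    = a ∸ 2
  g (suc i) = g' i

  2≤a : 2 ≤ a
  2≤a = ≤-trans (m≤n+m 2 _) l+2≤a

  g-dec : Decreasing g
  g-dec zero    = ≤-trans (g'≤ 0) (subst (_≤ a ∸ 2) (m+n∸n≡m (part l 0) 2) (∸-monoˡ-≤ 2 l+2≤a))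
  g-dec (suc i) = g'-dec i

  g≤ : ∀ i → g i ≤ part (a ∷ l) i
  g≤ zero    = m∸n≤m a 2
  g≤ (suc i) = g'≤ i

  top : ∀ j → g 0 ≤ j → j < a → j ≡ a ∸ 2 ⊎ j ≡ a ∸ 1
  top j = among-last-two a j 2≤a

module TopRowsMinus1 (h : ℕ) (l : List ℕ) (g' : ℕ → ℕ) (g'-dec : Decreasing g')
  (g'≤ : ∀ i → g' i ≤ part l i) (l<h : part l 0 < h) where
  g : ℕ → ℕ
  g zero          = h ∸ 1
  g (suc zero)    = h ∸ 1
  g (suc (suc i)) = g' i

  1≤h : 1 ≤ h
  1≤h = ≤-<-trans z≤n l<h

  g-dec : Decreasing g
  g-dec zero          = ≤-refl
  g-dec (suc zero)    = ≤-trans (g'≤ 0) (<⇒≤∸1 l<h)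
  g-dec (suc (suc i)) = g'-dec i

  g≤ : ∀ i → g i ≤ part (h ∷ h ∷ l) i
  g≤ zero          = m∸n≤m h 1
  g≤ (suc zero)    = m∸n≤m h 1
  g≤ (suc (suc i)) = g'≤ i

  top : ∀ j → h ∸ 1 ≤ j → j < h → j ≡ h ∸ 1
  top j = the-last h j

peel-pairHH : ∀ a l → IsPartition (a ∷ l) → part l 0 + 2 ≤ a → ∀ r → HorizontalAt l r → ∃ λ la' → Peel pairHH (a ∷ l) la'
peel-pairHH a l pal l+2≤a r hr = PeelByEmbedding.peel (a ∷ l) g T.g-dec T.g≤ pairHH 2 4
  (toWitness {a? = spans? pairHH 2 4} tt) R C (λ { zero _ → s≤s z≤n ; (suc _) (s≤s (s≤s ())) }) C-step onto into
  where
  pl = IsPartition-tail pal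
  module H = HorizontalProfile (part l) (part-suc≤part pl) r hr
  module T = TopRowMinus2 a l H.g H.g-dec H.g≤f l+2≤a
  open T using (g)
  x = H.x
  R : ℕ → ℕ
  R zero    = 0
  R (suc _) = suc r
  C : ℕ → ℕ
  C zero                = x ∸ 2
  C (suc zero)          = x ∸ 1
  C (suc (suc zero))    = a ∸ 2
  C (suc (suc (suc _))) = a ∸ 1
  C-step : ∀ b → suc b < 4 → C b < C (suc b)
  C-step zero             _ = x∸2<x∸1 x H.2≤x
  C-step (suc zero)       _ = x∸1<a∸2 x a (≤-trans (s≤s z≤n) H.2≤x) (≤-trans (+-monoˡ-≤ 2 (part-antitone pl z≤n)) l+2≤a)
  C-step (suc (suc zero)) _ = x∸2<x∸1 a T.2≤a
  C-step (suc (suc (suc b))) (s≤s (s≤s (s≤s (s≤s ()))))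
  onto : ∀ i j → g i ≤ j → j < part (a ∷ l) i → ∃ λ e → e ∈ pairHH × i ≡ R (proj₁ e) × j ≡ C (proj₂ e)
  onto zero j g≤j j<a with T.top j g≤j j<a
  ... | inj₁ refl = _ , here refl , refl , refl
  ... | inj₂ refl = _ , there (here refl) , refl , refl
  onto (suc i) j g≤j j<l with H.removed i j g≤j j<l
  ... | refl , inj₁ refl = _ , there (there (here refl)) , refl , refl
  ... | refl , inj₂ refl = _ , there (there (there (here refl))) , refl , refl
  into : ∀ e → e ∈ pairHH → g (R (proj₁ e)) ≤ C (proj₂ e) × C (proj₂ e) < part (a ∷ l) (R (proj₁ e))
  into _ (here refl)                         = ≤-refl , x∸2<x a T.2≤a
  into _ (there (here refl))                 = <⇒≤ (x∸2<x∸1 a T.2≤a) , x∸1<x a (≤-trans (s≤s z≤n) T.2≤a)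
  into _ (there (there (here refl)))         = H.g≤x∸2 , x∸2<x x H.2≤x
  into _ (there (there (there (here refl)))) = H.g≤x∸1 , x∸1<x x (≤-trans (s≤s z≤n) H.2≤x)

peel-pairHV : ∀ a l → IsPartition (a ∷ l) → part l 0 + 2 ≤ a → ∀ r → VerticalAt l r → ∃ λ la' → Peel pairHV (a ∷ l) la'
peel-pairHV a l pal l+2≤a r (hv , hl) = PeelByEmbedding.peel (a ∷ l) g T.g-dec T.g≤ pairHV 3 3
  (toWitness {a? = spans? pairHV 3 3} tt) R C R-step C-step onto into
  where
  pl = IsPartition-tail pal
  module V = VerticalProfile (part l) (part-suc≤part pl) r hv hl
  module T = TopRowMinus2 a l V.g V.g-dec V.g≤f l+2≤a
  open T using (g)
  x = V.x
  R : ℕ → ℕ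
  R zero          = 0
  R (suc zero)    = suc r
  R (suc (suc _)) = 2 + r
  R-step : ∀ b → suc b < 3 → R b < R (suc b)
  R-step zero       _ = s≤s z≤n
  R-step (suc zero) _ = n<1+n (suc r)
  R-step (suc (suc b)) (s≤s (s≤s (s≤s ())))
  C : ℕ → ℕ
  C zero          = x ∸ 1
  C (suc zero)    = a ∸ 2
  C (suc (suc _)) = a ∸ 1
  C-step : ∀ b → suc b < 3 → C b < C (suc b)
  C-step zero       _ = x∸1<a∸2 x a V.1≤x (≤-trans (+-monoˡ-≤ 2 (part-antitone pl z≤n)) l+2≤a)
  C-step (suc zero) _ = x∸2<x∸1 a T.2≤a
  C-step (suc (suc b)) (s≤s (s≤s (s≤s ())))
  onto : ∀ i j → g i ≤ j → j < part (a ∷ l) i → ∃ λ e → e ∈ pairHV × i ≡ R (proj₁ e) × j ≡ C (proj₂ e)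
  onto zero j g≤j j<a with T.top j g≤j j<a
  ... | inj₁ refl = _ , here refl , refl , refl
  ... | inj₂ refl = _ , there (here refl) , refl , refl
  onto (suc i) j g≤j j<l with V.removed i j g≤j j<l
  ... | inj₁ refl , refl = _ , there (there (here refl)) , refl , refl
  ... | inj₂ refl , refl = _ , there (there (there (here refl))) , refl , refl
  into : ∀ e → e ∈ pairHV → g (R (proj₁ e)) ≤ C (proj₂ e) × C (proj₂ e) < part (a ∷ l) (R (proj₁ e))
  into _ (here refl)                         = ≤-refl , x∸2<x a T.2≤a
  into _ (there (here refl))                 = <⇒≤ (x∸2<x∸1 a T.2≤a) , x∸1<x a (≤-trans (s≤s z≤n) T.2≤a)
  into _ (there (there (here refl)))         = V.g≤x∸1 , x∸1<x x V.1≤x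
  into _ (there (there (there (here refl)))) = V.g-suc≤x∸1 , V.x∸1<f-suc

peel-pairVV : ∀ h l → IsPartition (h ∷ h ∷ l) → part l 0 < h → ∀ r → VerticalAt l r → ∃ λ la' → Peel pairVV (h ∷ h ∷ l) la'
peel-pairVV h l pal l<h r (hv , hl) = PeelByEmbedding.peel (h ∷ h ∷ l) g T.g-dec T.g≤ pairVV 4 2
  (toWitness {a? = spans? pairVV 4 2} tt) R C R-step (λ { zero _ → C-step ; (suc _) (s≤s (s≤s ())) }) onto into
  where
  pl = IsPartition-tail (IsPartition-tail pal)
  module V = VerticalProfile (part l) (part-suc≤part pl) r hv hl
  module T = TopRowsMinus1 h l V.g V.g-dec V.g≤f l<h
  open T using (g)
  x = V.x
  R : ℕ → ℕ
  R zero                = 0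
  R (suc zero)          = 1
  R (suc (suc zero))    = 2 + r
  R (suc (suc (suc _))) = 3 + r
  R-step : ∀ b → suc b < 4 → R b < R (suc b)
  R-step zero             _ = s≤s z≤n
  R-step (suc zero)       _ = s≤s (s≤s z≤n)
  R-step (suc (suc zero)) _ = n<1+n (2 + r)
  R-step (suc (suc (suc b))) (s≤s (s≤s (s≤s (s≤s ()))))
  C : ℕ → ℕ
  C zero    = x ∸ 1
  C (suc _) = h ∸ 1
  C-step : C 0 < C 1
  C-step = ∸-monoˡ-< (≤-<-trans (part-antitone pl z≤n) l<h) V.1≤x
  onto : ∀ i j → g i ≤ j → j < part (h ∷ h ∷ l) i → ∃ λ e → e ∈ pairVV × i ≡ R (proj₁ e) × j ≡ C (proj₂ e)
  onto zero j g≤j j<h with T.top j g≤j j<h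
  ... | refl = _ , here refl , refl , refl
  onto (suc zero) j g≤j j<h with T.top j g≤j j<h
  ... | refl = _ , there (here refl) , refl , refl
  onto (suc (suc i)) j g≤j j<l with V.removed i j g≤j j<l
  ... | inj₁ refl , refl = _ , there (there (here refl)) , refl , refl
  ... | inj₂ refl , refl = _ , there (there (there (here refl))) , refl , refl
  into : ∀ e → e ∈ pairVV → g (R (proj₁ e)) ≤ C (proj₂ e) × C (proj₂ e) < part (h ∷ h ∷ l) (R (proj₁ e))
  into _ (here refl)                         = ≤-refl , x∸1<x h T.1≤h
  into _ (there (here refl))                 = ≤-refl , x∸1<x h T.1≤h
  into _ (there (there (here refl)))         = V.g≤x∸1 , x∸1<x x V.1≤x
  into _ (there (there (there (here refl)))) = V.g-suc≤x∸1 , V.x∸1<f-suc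

peel-pairVH : ∀ h l → IsPartition (h ∷ h ∷ l) → part l 0 < h → ∀ r → HorizontalAt l r → ∃ λ la' → Peel pairVH (h ∷ h ∷ l) la'
peel-pairVH h l pal l<h r hr = PeelByEmbedding.peel (h ∷ h ∷ l) g T.g-dec T.g≤ pairVH 3 3
  (toWitness {a? = spans? pairVH 3 3} tt) R C R-step C-step onto into
  where
  pl = IsPartition-tail (IsPartition-tail pal)
  module H = HorizontalProfile (part l) (part-suc≤part pl) r hr
  module T = TopRowsMinus1 h l H.g H.g-dec H.g≤f l<h
  open T using (g)
  x = H.x
  R : ℕ → ℕ
  R zero          = 0
  R (suc zero)    = 1
  R (suc (suc _)) = 2 + r
  R-step : ∀ b → suc b < 3 → R b < R (suc b)
  R-step zero       _ = s≤s z≤n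
  R-step (suc zero) _ = s≤s (s≤s z≤n)
  R-step (suc (suc b)) (s≤s (s≤s (s≤s ())))
  C : ℕ → ℕ
  C zero          = x ∸ 2
  C (suc zero)    = x ∸ 1
  C (suc (suc _)) = h ∸ 1
  C-step : ∀ b → suc b < 3 → C b < C (suc b)
  C-step zero       _ = x∸2<x∸1 x H.2≤x
  C-step (suc zero) _ = ∸-monoˡ-< (≤-<-trans (part-antitone pl z≤n) l<h) (≤-trans (s≤s z≤n) H.2≤x)
  C-step (suc (suc b)) (s≤s (s≤s (s≤s ())))
  onto : ∀ i j → g i ≤ j → j < part (h ∷ h ∷ l) i → ∃ λ e → e ∈ pairVH × i ≡ R (proj₁ e) × j ≡ C (proj₂ e)
  onto zero j g≤j j<h with T.top j g≤j j<h
  ... | refl = _ , here refl , refl , refl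
  onto (suc zero) j g≤j j<h with T.top j g≤j j<h
  ... | refl = _ , there (here refl) , refl , refl
  onto (suc (suc i)) j g≤j j<l with H.removed i j g≤j j<l
  ... | refl , inj₁ refl = _ , there (there (here refl)) , refl , refl
  ... | refl , inj₂ refl = _ , there (there (there (here refl))) , refl , refl
  into : ∀ e → e ∈ pairVH → g (R (proj₁ e)) ≤ C (proj₂ e) × C (proj₂ e) < part (h ∷ h ∷ l) (R (proj₁ e))
  into _ (here refl)                         = ≤-refl , x∸1<x h T.1≤h
  into _ (there (here refl))                 = ≤-refl , x∸1<x h T.1≤h
  into _ (there (there (here refl)))         = H.g≤x∸2 , x∸2<x x H.2≤x
  into _ (there (there (there (here refl)))) = H.g≤x∸1 , x∸1<x x (≤-trans (s≤s z≤n) H.2≤x)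

-- Partitions with s = 0

fourInRow∈ : fourInRow ∈ tetrominos
fourInRow∈ = here refl
square∈ : square ∈ tetrominos
square∈ = there (here refl)
zigzag∈ : zigzag ∈ tetrominos
zigzag∈ = there (there (here refl))
hook∈ : hook ∈ tetrominos
hook∈ = there (there (there (here refl)))
pairHH∈ : pairHH ∈ tetrominos
pairHH∈ = there (there (there (there (there (here refl)))))
pairVV∈ : pairVV ∈ tetrominos
pairVV∈ = there (there (there (there (there (there (here refl))))))
pairHV∈ : pairHV ∈ tetrominos
pairHV∈ = there (there (there (there (there (there (there (here refl)))))))
pairVH∈ : pairVH ∈ tetrominos
pairVH∈ = there (there (there (there (there (there (there (there (here refl))))))))

-- Below a row at least two boxes longer than the next one, a peelable domino would
-- combine with the last two boxes of that row into a peelable tetromino.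
staircase-below-long-row : ∀ a l → IsPartition (a ∷ l) → TetNumber (a ∷ l) 0 → part l 0 + 2 ≤ a →
  ∃ λ n → l ≡ staircase n
staircase-below-long-row a l pal s0 l+2≤a with staircase-or-dominoPeelable l (IsPartition-tail pal)
... | inj₁ isStaircase     = isStaircase
... | inj₂ (inj₁ (r , hr)) = ⊥-elim (noPeel s0 pairHH∈ (proj₂ (peel-pairHH a l pal l+2≤a r hr)))
... | inj₂ (inj₂ (r , vr)) = ⊥-elim (noPeel s0 pairHV∈ (proj₂ (peel-pairHV a l pal l+2≤a r vr)))

staircase-below-equal-rows : ∀ h l → IsPartition (h ∷ h ∷ l) → TetNumber (h ∷ h ∷ l) 0 → part l 0 < h →
  ∃ λ n → l ≡ staircase n
staircase-below-equal-rows h l pal s0 l<h with staircase-or-dominoPeelable l (IsPartition-tail (IsPartition-tail pal))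
... | inj₁ isStaircase     = isStaircase
... | inj₂ (inj₁ (r , hr)) = ⊥-elim (noPeel s0 pairVH∈ (proj₂ (peel-pairVH h l pal l<h r hr)))
... | inj₂ (inj₂ (r , vr)) = ⊥-elim (noPeel s0 pairVV∈ (proj₂ (peel-pairVV h l pal l<h r vr)))

data TetFreeShape : List ℕ → Set where
  empty       : TetFreeShape []
  stairColumn : ∀ n k → TetFreeShape (staircase (suc n) ++ replicate k 1)
  stacked     : ∀ q p → TetFreeShape (map (_+ (q + 2)) (staircase (suc p)) ++ staircase q)
  widened     : ∀ m → TetFreeShape (map suc (staircase (suc m)))

TetFreeShape-grow : ∀ {l} → TetFreeShape l → TetFreeShape (suc (part l 0) ∷ l)
TetFreeShape-grow empty             = stairColumn 0 0
TetFreeShape-grow (stairColumn n k) = stairColumn (suc n) k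
TetFreeShape-grow (stacked q p)     = stacked q (suc p)
TetFreeShape-grow (widened m)       = widened (suc m)

TetFreeShape-column : ∀ {l} → TetFreeShape l → part l 0 ≡ 1 → TetFreeShape (1 ∷ l)
TetFreeShape-column (stairColumn zero k) _ = stairColumn 0 (suc k)
TetFreeShape-column (stacked q p) top≡1 = ⊥-elim (<-irrefl (sym top≡1) (s≤s (≤-trans (subst (1 ≤_) (+-comm 2 q) (s≤s z≤n)) (m≤n+m (q + 2) p))))

TetFreeShape-top-strict : ∀ {l} → TetFreeShape l → 2 ≤ part l 0 → part l 1 < part l 0
TetFreeShape-top-strict (stairColumn zero k)    (s≤s ())
TetFreeShape-top-strict (stairColumn (suc n) k) _ = ≤-refl
TetFreeShape-top-strict (stacked q zero)        _ = subst (_< suc (q + 2)) (sym (part-staircase q 0)) (s≤s (m≤m+n q 2))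
TetFreeShape-top-strict (stacked q (suc p))     _ = ≤-refl
TetFreeShape-top-strict (widened zero)          _ = s≤s z≤n
TetFreeShape-top-strict (widened (suc m))       _ = ≤-refl

classify-equal-top : ∀ l → IsPartition (part l 0 ∷ l) → TetNumber (part l 0 ∷ l) 0 → TetFreeShape l →
  TetFreeShape (part l 0 ∷ l)
classify-equal-top []                 pal _  _     = ⊥-elim (<-irrefl refl (IsPartition-head>0 pal))
classify-equal-top (zero ∷ _)         pal _  _     = ⊥-elim (<-irrefl refl (IsPartition-head>0 pal))
classify-equal-top (suc zero ∷ l)     _   _  shape = TetFreeShape-column shape refl
classify-equal-top (suc (suc k) ∷ l)  pal s0 shape
  with staircase-below-equal-rows (2 + k) l pal s0 (TetFreeShape-top-strict shape (s≤s (s≤s z≤n)))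
... | m , refl with m ≤? k
... | yes m≤k = ⊥-elim (noPeel s0 square∈ (proj₂ (peel-square k (staircase m) pal (subst (_≤ k) (sym (part-staircase m 0)) m≤k))))
... | no m≰k with ≤-antisym (m<1+n⇒m≤n (subst (_< 2 + k) (part-staircase m 0) (TetFreeShape-top-strict shape (s≤s (s≤s z≤n))))) (≰⇒> m≰k)
... | refl = ⊥-elim (noPeel s0 zigzag∈ (proj₂ (peel-zigzag k (staircase k) pal (≤-reflexive (part-staircase k 0)))))

classify-cons : ∀ l d → IsPartition (part l 0 + d ∷ l) → TetNumber (part l 0 + d ∷ l) 0 → TetFreeShape l →
  TetFreeShape (part l 0 + d ∷ l)
classify-cons l zero pal s0 shape = subst (λ a → TetFreeShape (a ∷ l)) (sym (+-identityʳ (part l 0)))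
  (classify-equal-top l (subst (λ a → IsPartition (a ∷ l)) (+-identityʳ _) pal)
                        (subst (λ a → TetNumber (a ∷ l) 0) (+-identityʳ _) s0) shape)
classify-cons l 1 pal s0 shape = subst (λ a → TetFreeShape (a ∷ l)) (+-comm 1 (part l 0)) (TetFreeShape-grow shape)
classify-cons l 2 pal s0 shape with staircase-below-long-row _ l pal s0 ≤-refl
... | zero  , refl = widened 0
... | suc m , refl rewrite +-comm m 2 =
  ⊥-elim (noPeel s0 hook∈ (proj₂ (peel-hook m (staircase m) pal (≤-reflexive (part-staircase m 0)))))
classify-cons l 3 pal s0 shape with staircase-below-long-row _ l pal s0 (+-monoʳ-≤ (part l 0) (n≤1+n 2))
... | n , refl = subst (λ a → TetFreeShape (a ∷ staircase n)) (trans (sym (+-suc n 2)) (cong (_+ 3) (sym (part-staircase n 0)))) (stacked n 0)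
classify-cons l (suc (suc (suc (suc e)))) pal s0 _ =
  ⊥-elim (noPeel s0 fourInRow∈ (proj₂ (peel-fourInRow _ l pal (+-monoʳ-≤ (part l 0) (s≤s (s≤s (s≤s (s≤s z≤n))))))))

classify : ∀ l → IsPartition l → TetNumber l 0 → TetFreeShape l
classify []      _   _  = empty
classify (a ∷ l) pal s0 = subst (λ a → TetFreeShape (a ∷ l)) top≡a
  (classify-cons l (a ∸ part l 0) (subst (λ a → IsPartition (a ∷ l)) (sym top≡a) pal)
                                  (subst (λ a → TetNumber (a ∷ l) 0) (sym top≡a) s0)
                                  (classify l (IsPartition-tail pal) (TetNumber0-tail pal s0)))
  where
  top≡a : part l 0 + (a ∸ part l 0) ≡ a
  top≡a = m+[n∸m]≡n (part-suc≤part pal 0)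

-- Boxes outside the first column

sumBelow : (ℕ → ℕ) → ℕ → ℕ
sumBelow f zero    = 0
sumBelow f (suc n) = f 0 + sumBelow (f ∘ suc) n

sumBelow-cong : ∀ f g n → (∀ i → f i ≡ g i) → sumBelow f n ≡ sumBelow g n
sumBelow-cong f g zero    _   = refl
sumBelow-cong f g (suc n) f≡g = cong₂ _+_ (f≡g 0) (sumBelow-cong _ _ n (f≡g ∘ suc))

offFirstColumn : List Cell → ℕ
offFirstColumn S = length (filter (λ c → 1 ≤? proj₂ c) S)

offFirstColumn-++ : ∀ A B → offFirstColumn (A ++ B) ≡ offFirstColumn A + offFirstColumn B
offFirstColumn-++ A B = trans (cong length (filter-++ (λ c → 1 ≤? proj₂ c) A B)) (length-++ (filter (λ c → 1 ≤? proj₂ c) A))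

offFirstColumn-row : ∀ i js → offFirstColumn (map (i ,_) js) ≡ length (filter (1 ≤?_) js)
offFirstColumn-row i [] = refl
offFirstColumn-row i (j ∷ js) with 1 ≤? j
... | yes 1≤j = trans (cong length (filter-accept (λ c → 1 ≤? proj₂ c) {x = i , j} 1≤j))
                     (trans (cong suc (offFirstColumn-row i js)) (sym (cong length (filter-accept (1 ≤?_) {x = j} 1≤j))))
... | no  1≰j = trans (cong length (filter-reject (λ c → 1 ≤? proj₂ c) {x = i , j} 1≰j))
                     (trans (offFirstColumn-row i js) (sym (cong length (filter-reject (1 ≤?_) {x = j} 1≰j))))

offFirstColumn-concatMap : ∀ (F : ℕ → List Cell) s n →
  offFirstColumn (concatMap F (applyUpTo s n)) ≡ sumBelow (λ i → offFirstColumn (F (s i))) n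
offFirstColumn-concatMap F s zero    = refl
offFirstColumn-concatMap F s (suc n) = trans (offFirstColumn-++ (F (s 0)) (concatMap F (applyUpTo (s ∘ suc) n)))
                                             (cong (offFirstColumn (F (s 0)) +_) (offFirstColumn-concatMap F (s ∘ suc) n))

positive-range : ∀ a b → 1 ≤ a → All (1 ≤_) (range a b)
positive-range a b 1≤a = All.tabulate λ j∈ → ≤-trans 1≤a (proj₁ (∈-range⁻ {a} {b} j∈))

count-positive-range : ∀ a b → length (filter (1 ≤?_) (range a b)) ≡ b ∸ (a ⊔ 1)
count-positive-range (suc a) b = begin
  length (filter (1 ≤?_) (range (suc a) b)) ≡⟨ cong length (filter-all (1 ≤?_) (positive-range (suc a) b (s≤s z≤n))) ⟩
  length (range (suc a) b)                  ≡⟨ length-map (suc a +_) (upTo (b ∸ suc a)) ⟩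
  length (upTo (b ∸ suc a))                 ≡⟨ length-upTo (b ∸ suc a) ⟩
  b ∸ suc a                                 ≡⟨ cong (λ z → b ∸ suc z) (⊔-identityʳ a) ⟨
  b ∸ (suc a ⊔ 1)                           ∎
  where open ≡-Reasoning
count-positive-range zero zero    = refl
count-positive-range zero (suc b) = begin
  length (filter (1 ≤?_) (0 ∷ map (0 +_) (applyUpTo suc b))) ≡⟨ cong length (filter-reject (1 ≤?_) {x = 0} {xs = map (0 +_) (applyUpTo suc b)} (λ ())) ⟩
  length (filter (1 ≤?_) (map (0 +_) (applyUpTo suc b)))     ≡⟨ cong length (filter-all (1 ≤?_) all≥1) ⟩
  length (map (0 +_) (applyUpTo suc b))                      ≡⟨ length-map (0 +_) (applyUpTo suc b) ⟩
  length (applyUpTo suc b)                                   ≡⟨ length-applyUpTo suc b ⟩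
  b                                                          ∎
  where
  open ≡-Reasoning
  all≥1 : All (1 ≤_) (map (0 +_) (applyUpTo suc b))
  all≥1 = map⁺ (applyUpTo⁺₂ suc b (λ _ → s≤s z≤n))

-- the ⊔ 1 discards the box in column 0 when mu has no box in that row
rowExcess : List ℕ → List ℕ → ℕ
rowExcess la mu = sumBelow (λ i → part la i ∸ (part mu i ⊔ 1)) (length la)

b≡rowExcess : ∀ la mu → b la mu ≡ rowExcess la mu
b≡rowExcess la mu = trans (offFirstColumn-concatMap (λ i → map (i ,_) (range (part mu i) (part la i))) (λ i → i) (length la))
  (sumBelow-cong _ _ (length la) λ i → trans (offFirstColumn-row i (range (part mu i) (part la i)))
                                             (count-positive-range (part mu i) (part la i)))

private
  1+n⊔1 : ∀ n → suc n ⊔ 1 ≡ suc n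
  1+n⊔1 n = cong suc (⊔-identityʳ n)

rowExcess-staircase++ : ∀ n L → rowExcess (staircase n ++ L) (staircase n) ≡ rowExcess L []
rowExcess-staircase++ zero    L = refl
rowExcess-staircase++ (suc n) L = cong₂ _+_ (trans (cong (suc n ∸_) (1+n⊔1 n)) (n∸n≡0 (suc n))) (rowExcess-staircase++ n L)

rowExcess-staircase : ∀ n → rowExcess (staircase n) (staircase n) ≡ 0
rowExcess-staircase zero    = refl
rowExcess-staircase (suc n) = cong₂ _+_ (trans (cong (suc n ∸_) (1+n⊔1 n)) (n∸n≡0 (suc n))) (rowExcess-staircase n)

rowExcess-ones : ∀ k → rowExcess (replicate k 1) [] ≡ 0
rowExcess-ones zero    = refl
rowExcess-ones (suc k) = rowExcess-ones k

rowExcess-staircase-2+ : ∀ n L → rowExcess (staircase (2 + n) ++ L) (staircase n) ≡ suc (n + n) + rowExcess L []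
rowExcess-staircase-2+ zero    L = refl
rowExcess-staircase-2+ (suc n) L = begin
  (3 + n ∸ (suc n ⊔ 1)) + rowExcess (staircase (2 + n) ++ L) (staircase n) ≡⟨ cong₂ _+_ 2-boxes (rowExcess-staircase-2+ n L) ⟩
  2 + (suc (n + n) + rowExcess L [])                                     ≡⟨ cong (λ z → 2 + z + rowExcess L []) (+-suc n n) ⟨
  suc (suc n + suc n) + rowExcess L []                                   ∎
  where
  open ≡-Reasoning
  2-boxes : 3 + n ∸ (suc n ⊔ 1) ≡ 2
  2-boxes = trans (cong (3 + n ∸_) (1+n⊔1 n)) (m+n∸n≡m 2 (suc n))

rowExcess-stacked : ∀ q p → rowExcess (map (_+ (q + 2)) (staircase (suc p)) ++ staircase q) (staircase (suc p + q)) ≡ suc p + suc p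
rowExcess-stacked q zero = cong₂ _+_ 2-boxes (rowExcess-staircase q)
  where
  2-boxes : suc (q + 2) ∸ (suc q ⊔ 1) ≡ 2
  2-boxes = trans (cong₂ _∸_ (cong suc (+-comm q 2)) (1+n⊔1 q)) (m+n∸n≡m 2 (suc q))
rowExcess-stacked q (suc p) = trans (cong₂ _+_ 2-boxes (rowExcess-stacked q p)) (cong suc (sym (+-suc (suc p) (suc p))))
  where
  2-boxes : 2 + p + (q + 2) ∸ (2 + p + q ⊔ 1) ≡ 2
  2-boxes = trans (cong₂ _∸_ (trans (sym (+-assoc (2 + p) q 2)) (+-comm (2 + p + q) 2)) (1+n⊔1 (suc p + q)))
                  (m+n∸n≡m 2 (2 + p + q))

rowExcess-widened : ∀ m → rowExcess (map suc (staircase (suc m))) (staircase m) ≡ suc (m + m)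
rowExcess-widened zero    = refl
rowExcess-widened (suc m) = trans (cong₂ _+_ (trans (cong (3 + m ∸_) (1+n⊔1 m)) (m+n∸n≡m 2 (suc m))) (rowExcess-widened m))
                                  (cong (2 +_) (sym (+-suc m m)))

alternatingParity-ones-even : ∀ j → alternatingParity (replicate (j + j) 1) ≡ pos 0
alternatingParity-ones-even zero    = refl
alternatingParity-ones-even (suc j) = begin
  alternatingParity (replicate (suc (j + suc j)) 1)     ≡⟨ cong (λ z → alternatingParity (replicate (suc z) 1)) (+-suc j j) ⟩
  pos 1 -ℤ (pos 1 -ℤ alternatingParity (replicate (j + j) 1)) ≡⟨ x-[x-y]≡y (pos 1) _ ⟩
  alternatingParity (replicate (j + j) 1)               ≡⟨ alternatingParity-ones-even j ⟩
  pos 0                                                 ∎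
  where open ≡-Reasoning

alternatingParity-ones-odd : ∀ j → alternatingParity (replicate (suc (j + j)) 1) ≡ pos 1
alternatingParity-ones-odd j = cong (pos 1 -ℤ_) (alternatingParity-ones-even j)

alternatingParity-++-even : ∀ m L → alternatingParity L ≡ pos 0 → alternatingParity (staircase m ++ L) ≡ alternatingParity (staircase m)
alternatingParity-++-even zero    L e = e
alternatingParity-++-even (suc m) L e = cong (parity (suc m) -ℤ_) (alternatingParity-++-even m L e)

alternatingParity-++-odd : ∀ n L → alternatingParity L ≡ pos 1 → alternatingParity (staircase (2 + n) ++ L) ≡ alternatingParity (staircase n)
alternatingParity-++-odd zero    L e = cong (λ z → pos 0 -ℤ (pos 1 -ℤ z)) e
alternatingParity-++-odd (suc n) L e = cong (parity (suc n) -ℤ_) (alternatingParity-++-odd n L e)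

alternatingParity-stacked : ∀ q p → alternatingParity (map (_+ (q + 2)) (staircase (suc p)) ++ staircase q) ≡ alternatingParity (staircase (suc p + q))
alternatingParity-stacked q zero    = cong (_-ℤ alternatingParity (staircase q)) (parity-+2 (suc q))
alternatingParity-stacked q (suc p) = cong₂ _-ℤ_ (trans (cong parity (sym (+-assoc p q 2))) (parity-+2 (p + q))) (alternatingParity-stacked q p)

alternatingParity-widened : ∀ m → alternatingParity (map suc (staircase (suc m))) ≡ alternatingParity (staircase m)
alternatingParity-widened zero    = refl
alternatingParity-widened (suc m) = cong (parity (suc m) -ℤ_) (alternatingParity-widened m)

parity-even : ∀ j → parity (j + j) ≡ pos 0
parity-even zero    = refl
parity-even (suc j) = trans (cong (parity ∘ suc) (+-suc j j)) (parity-even j)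

parity-odd : ∀ j → parity (suc (j + j)) ≡ pos 1
parity-odd zero    = refl
parity-odd (suc j) = trans (cong (parity ∘ suc ∘ suc) (+-suc j j)) (parity-odd j)

alternatingParity-staircase-even : ∀ j → alternatingParity (staircase (j + j)) ≡ - pos j
alternatingParity-staircase-odd  : ∀ j → alternatingParity (staircase (suc (j + j))) ≡ pos (suc j)
alternatingParity-staircase-even zero    = refl
alternatingParity-staircase-even (suc j) = trans (cong (alternatingParity ∘ staircase ∘ suc) (+-suc j j))
  (trans (cong₂ _-ℤ_ (parity-even j) (alternatingParity-staircase-odd j)) (ℤ.+-identityˡ (- pos (suc j))))
alternatingParity-staircase-odd j = trans (cong₂ _-ℤ_ (parity-odd j) (alternatingParity-staircase-even j))
  (cong (pos 1 +ℤ_) (ℤ.neg-involutive (pos j)))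

even-or-odd : ∀ w → ∃ λ j → w ≡ j + j ⊎ w ≡ suc (j + j)
even-or-odd zero = 0 , inj₁ refl
even-or-odd (suc w) with even-or-odd w
... | j , inj₁ refl = j , inj₂ refl
... | j , inj₂ refl = suc j , inj₁ (cong suc (sym (+-suc j j)))

-pos≢pos+1 : ∀ j j' → - pos j ≢ pos (suc j')
-pos≢pos+1 zero    _ ()
-pos≢pos+1 (suc j) _ ()

-- The staircase of width 2j has alternating parity −j, that of width 2j + 1 has j + 1.
alternatingParity-staircase-injective : ∀ w w' → alternatingParity (staircase w) ≡ alternatingParity (staircase w') → w ≡ w'
alternatingParity-staircase-injective w w' e with even-or-odd w | even-or-odd w'
... | j , inj₁ refl | j' , inj₁ refl = cong (λ z → z + z) (ℤ.+-injective (ℤ.neg-injective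
      (trans (sym (alternatingParity-staircase-even j)) (trans e (alternatingParity-staircase-even j')))))
... | j , inj₂ refl | j' , inj₂ refl = cong (λ z → suc (z + z)) (suc-injective (ℤ.+-injective
      (trans (sym (alternatingParity-staircase-odd j)) (trans e (alternatingParity-staircase-odd j')))))
... | j , inj₁ refl | j' , inj₂ refl = ⊥-elim (-pos≢pos+1 j j'
      (trans (sym (alternatingParity-staircase-even j)) (trans e (alternatingParity-staircase-odd j'))))
... | j , inj₂ refl | j' , inj₁ refl = ⊥-elim (-pos≢pos+1 j' j
      (trans (sym (alternatingParity-staircase-even j')) (trans (sym e) (alternatingParity-staircase-odd j))))

private
  1+m+m≡2m+1 : ∀ m → suc (m + m) ≡ 2 * m + 1
  1+m+m≡2m+1 m = trans (+-comm 1 (m + m)) (cong (λ z → m + z + 1) (sym (+-identityʳ m)))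

  m+m≤2n+1 : ∀ {m n} → m ≤ n → m + m ≤ 2 * n + 1
  m+m≤2n+1 {m} {n} m≤n = ≤-trans (+-mono-≤ m≤n m≤n) (≤-trans (n≤1+n (n + n)) (≤-reflexive (1+m+m≡2m+1 n)))

rowExcess-bound : ∀ la w → TetFreeShape la → alternatingParity (staircase w) ≡ alternatingParity la →
  rowExcess la (staircase w) ≤ 2 * w + 1
rowExcess-bound [] w empty _ = z≤n
rowExcess-bound _ w (stairColumn n k) e with even-or-odd k
... | j , inj₁ refl with alternatingParity-staircase-injective w (suc n)
                           (trans e (alternatingParity-++-even (suc n) _ (alternatingParity-ones-even j)))
... | refl = ≤-trans (≤-reflexive (trans (rowExcess-staircase++ (suc n) _) (rowExcess-ones (j + j)))) z≤n
rowExcess-bound _ w (stairColumn zero k) e | j , inj₂ refl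
  with alternatingParity-staircase-injective w 0 (trans e (cong (pos 1 -ℤ_) (alternatingParity-ones-odd j)))
... | refl = ≤-trans (≤-reflexive (rowExcess-ones (2 + (j + j)))) z≤n
rowExcess-bound _ w (stairColumn (suc m) k) e | j , inj₂ refl
  with alternatingParity-staircase-injective w m (trans e (alternatingParity-++-odd m _ (alternatingParity-ones-odd j)))
... | refl = ≤-reflexive (begin
  rowExcess (staircase (2 + m) ++ replicate (suc (j + j)) 1) (staircase m) ≡⟨ rowExcess-staircase-2+ m _ ⟩
  suc (m + m) + rowExcess (replicate (suc (j + j)) 1) []                  ≡⟨ cong (suc (m + m) +_) (rowExcess-ones (suc (j + j))) ⟩
  suc (m + m) + 0                                                         ≡⟨ +-identityʳ _ ⟩
  suc (m + m)                                                             ≡⟨ 1+m+m≡2m+1 m ⟩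
  2 * m + 1                                                               ∎)
  where open ≡-Reasoning
rowExcess-bound _ w (stacked q p) e with alternatingParity-staircase-injective w (suc p + q) (trans e (alternatingParity-stacked q p))
... | refl = ≤-trans (≤-reflexive (rowExcess-stacked q p)) (m+m≤2n+1 (m≤m+n (suc p) q))
rowExcess-bound _ w (widened m) e with alternatingParity-staircase-injective w m (trans e (alternatingParity-widened m))
... | refl = ≤-reflexive (trans (rowExcess-widened m) (1+m+m≡2m+1 m))

corollary4p3 : (la mu : List ℕ) → IsPartition la → TetNumber la 0 →
    StaircaseOf la mu → b la mu ≤ 2 * width mu + 1
corollary4p3 la mu pla s0 sc@(_ , _ , dominoSeq) with staircaseOf-isStaircase la mu pla sc
... | w , refl = begin
  b la (staircase w)                  ≡⟨ b≡rowExcess la (staircase w) ⟩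
  rowExcess la (staircase w)          ≤⟨ rowExcess-bound la w (classify la pla s0) (alternatingParity-dominoSeq dominoSeq pla) ⟩
  2 * w + 1                           ≡⟨ cong (λ z → 2 * z + 1) (part-staircase w 0) ⟨
  2 * width (staircase w) + 1         ∎
  where open ≤-Reasoning
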